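{- Let $n\geq 16$ be an integer and let $\omega_2(n)$ be the minimum wasted $2$-domination of a border-$2$-dominating set of $P_m\Box C_n$ (for any $m\ge 13$; the value does not depend on $m$), as defined in the context. Then $$\omega_2(n)=\begin{cases}2n+1 & \text{if } n\in\{16,19\},\\ 2n & \text{otherwise.}\end{cases}$$
   Context: $P_m$ is the path on $m$ vertices $a_1,\dots,a_m$ and $C_n$ the cycle on $n$ vertices $b_1,\dots,b_n$; $P_m\Box C_n$ is their Cartesian product with vertex set $V=\{v_{ij}=(a_i,b_j)\}$, where $(g_1,h_1)\sim(g_2,h_2)$ iff ($g_1=g_2$ and $h_1h_2$ is an edge) or ($g_1g_2$ is an edge and $h_1=h_2$). The $i$-th row is $\{v_{ij}:1\le j\le n\}$. Let $m\ge 13$, $V_1=\{v_{ij}:1\le i\le 5\}$ and $V_3=\{v_{ij}:m-4\le i\le m\}$; rows $1$–$4$ are the outer rows of $V_1$ and rows $m,m-1,m-2,m-3$ the outer rows of $V_3$. A set $R\subseteq V$ is border-$2$-dominating if (i) $R\subseteq V_1$ or $R\subseteq V_3$; (ii) if $R\subseteq V_1$ (resp. $V_3$), every vertex not in $R$ lying in the outer rows of $V_1$ (resp. $V_3$) has at least two neighbors in $R$; (iii) if $R\subseteq V_1$ (resp. $V_3$), every vertex not in $R$ lying in row $5$ (resp. row $m-4$) has at least one neighbor in $R$. For such $R$ let $A^R=\{v\in V\setminus R: v\text{ has at least two neighbors in }R\}$, $B^R=\{v\in V\setminus R: v \text{ has exactly one neighbor in } R\}$, and define the wasted $2$-domination $\omega_2(R)=4|R|-(2|A^R|+|B^R|)$.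 Then $\omega_2(n)=\min\{\omega_2(R): R\text{ is a border- }2\text{ -dominating set of } P_m\Box C_n\}$. -}

module Defs where

open import Data.Bool using (Bool; true; false; _∧_; _∨_; not; if_then_else_)
open import Data.Nat using (ℕ; zero; suc; _+_; _*_; _∸_; _≤_; _<_; _%_; _≡ᵇ_)
open import Data.Fin using (Fin; toℕ)
open import Data.Integer using (ℤ; +_; _-_)
open import Data.Product using (_×_)
open import Data.Sum using (_⊎_)
open import Relation.Binary.PropositionalEquality using (_≡_)

-- Vertex v_{ij} of P_m □ C_n is represented by (i , j) : Fin m × Fin n,
-- with row index  toℕ i + 1  and column index  toℕ j + 1  (0-based internally).

countFin : (K : ℕ) → (Fin K → Bool) → ℕ
countFin zero    f = 0
countFin (suc K) f = (if f Fin.zero then 1 else 0) + countFin K (λ k → f (Fin.suc k))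

sumFin : (K : ℕ) → (Fin K → ℕ) → ℕ
sumFin zero    f = 0
sumFin (suc K) f = f Fin.zero + sumFin K (λ k → f (Fin.suc k))

countV : (m n : ℕ) → (Fin m → Fin n → Bool) → ℕ
countV m n P = sumFin m (λ i → countFin n (λ j → P i j))

pathAdj : {m : ℕ} → Fin m → Fin m → Bool
pathAdj i i' = ((toℕ i + 1) ≡ᵇ toℕ i') ∨ ((toℕ i' + 1) ≡ᵇ toℕ i)

cycleAdj : {n : ℕ} → Fin n → Fin n → Bool
cycleAdj {zero}  j j' = false
cycleAdj {suc n} j j' =
  (((toℕ j + 1) % suc n) ≡ᵇ toℕ j') ∨ (((toℕ j' + 1) % suc n) ≡ᵇ toℕ j)

finEq : {k : ℕ} → Fin k → Fin k → Bool
finEq a b = toℕ a ≡ᵇ toℕ b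

adj : {m n : ℕ} → Fin m → Fin n → Fin m → Fin n → Bool
adj i j i' j' = (finEq i i' ∧ cycleAdj j j') ∨ (pathAdj i i' ∧ finEq j j')

VSet : ℕ → ℕ → Set
VSet m n = Fin m → Fin n → Bool

nbrsIn : {m n : ℕ} → VSet m n → Fin m → Fin n → ℕ
nbrsIn {m} {n} R i j = countV m n (λ i' j' → R i' j' ∧ adj i j i' j')

inA : {m n : ℕ} → VSet m n → Fin m → Fin n → Bool
inA R i j = not (R i j) ∧ not (nbrsIn R i j ≡ᵇ 0) ∧ not (nbrsIn R i j ≡ᵇ 1)

inB : {m n : ℕ} → VSet m n → Fin m → Fin n → Bool
inB R i j = not (R i j) ∧ (nbrsIn R i j ≡ᵇ 1)

ω₂ : {m n : ℕ} → VSet m n → ℤ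
ω₂ {m} {n} R = + (4 * countV m n R) - + (2 * countV m n (inA R) + countV m n (inB R))

-- V_1 = rows 1..5 ;  outer rows 1..4 ; row 5
-- V_3 = rows m-4..m ; outer rows m-3..m ; row m-4
Border2DomV1 : {m n : ℕ} → VSet m n → Set
Border2DomV1 {m} {n} R =
  (∀ (i : Fin m) (j : Fin n) → R i j ≡ true → toℕ i < 5)
  × (∀ (i : Fin m) (j : Fin n) → toℕ i < 4 → R i j ≡ false → 2 ≤ nbrsIn R i j)
  × (∀ (i : Fin m) (j : Fin n) → toℕ i ≡ 4 → R i j ≡ false → 1 ≤ nbrsIn R i j)

Border2DomV3 : {m n : ℕ} → VSet m n → Set
Border2DomV3 {m} {n} R =
  (∀ (i : Fin m) (j : Fin n) → R i j ≡ true → m ∸ 5 ≤ toℕ i)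
  × (∀ (i : Fin m) (j : Fin n) → m ∸ 4 ≤ toℕ i → R i j ≡ false → 2 ≤ nbrsIn R i j)
  × (∀ (i : Fin m) (j : Fin n) → toℕ i ≡ m ∸ 5 → R i j ≡ false → 1 ≤ nbrsIn R i j)

Border2Dominating : {m n : ℕ} → VSet m n → Set
Border2Dominating R = Border2DomV1 R ⊎ Border2DomV3 R

ω₂-value : ℕ → ℤ
ω₂-value n = if (n ≡ᵇ 16) ∨ (n ≡ᵇ 19) then + (2 * n + 1) else + (2 * n)

-- Reflecting the rows turns a border-2-dominating set inside V₃ into one inside V₁ with the
-- same wasted domination, so only sets inside V₁ matter. Such a set is a cyclic word of
-- columns (subsets of the rows 1..5), and ω₂(R) is the sum over the columns of what a column
-- sends (4 per vertex of R) minus what it receives (min(2, #neighbours in R) per vertex outside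
-- R); what a column receives depends only on the column and its two neighbours. A potential φ
-- on pairs of consecutive columns, checked on all 2¹⁵ triples, gives
--   8 (sent b − received (a, b, c)) ≥ 16 + φ(b, c) − φ(a, b) + [(a, b, c) is not critical]
-- for every admissible triple, and summing around the cycle yields 8 ω₂ ≥ 16 n + #non-critical.
-- The pairs linked by critical triples form a small graph without closed walks of length 16 or
-- 19, which gives ω₂ ≥ 2n + 1 for those n. Conversely, words built from blocks of length 3 and
-- 11 (every n ≥ 20 and n = 17, 18 is 3q + 11r) attain 2n, as a second potential shows, and two
-- explicit words attain 33 and 39 for n = 16 and 19.
module Submission where

open import Data.Bool using (Bool; true; false; _∧_; _∨_; not; if_then_else_; T)
open import Data.Bool.ListAction using (all)
open import Data.Bool.Properties using (∧-assoc; ∧-identityʳ; ∨-identityʳ; T-∧; T-∨; T-≡) renaming (_≟_ to _≟ᵇ_)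
open import Data.Empty using (⊥; ⊥-elim)
open import Data.Fin using (Fin; toℕ; fromℕ<; inject₁; fromℕ; opposite)
open import Data.Fin.Properties using (toℕ<n; toℕ-fromℕ<; fromℕ<-toℕ; opposite-prop)
import Data.Integer as ℤ
open import Data.Integer.Properties using ([+m]-[+n]≡m⊖n; ⊖-≥)
open import Data.List
  using (List; []; _∷_; _++_; length; map; concatMap; cartesianProduct; cartesianProductWith; deduplicate)
open import Data.List.Membership.Propositional using (_∈_; lose)
open import Data.List.Membership.Propositional.Properties
  using (∈-map⁺; ∈-concatMap⁺; ∈-deduplicate⁺; ∈-cartesianProduct⁺; ∈-cartesianProductWith⁺)
import Data.List.Relation.Unary.All as All
open import Data.List.Relation.Unary.All.Properties using (all⁺)
open import Data.List.Relation.Unary.Any using (here; there)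
open import Data.Nat
open import Data.Nat.DivMod using (m<n⇒m%n≡m; n%n≡0)
open import Data.Nat.GeneralisedArithmetic using (fold)
open import Data.Nat.Properties
open import Data.Nat.Solver using (module +-*-Solver)
open import Data.Product using (_×_; _,_; proj₁; proj₂; ∃)
open import Data.Product.Properties using (≡-dec)
open import Data.Sum using (_⊎_; inj₁; inj₂; reduce; [_,_]′)
open import Function using (_∘_)
open import Function.Bundles using (Equivalence)
open import Relation.Binary.Definitions using (DecidableEquality)
open import Relation.Binary.PropositionalEquality
open import Relation.Nullary using (¬_; yes; no; Dec)
open import Relation.Nullary.Decidable using (isYes; isNo; toWitness; toWitnessFalse)
open +-*-Solver using (solve; _:+_; _:*_; con; _:=_)

open import Defs

sum< : ℕ → (ℕ → ℕ) → ℕ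
sum< zero    f = 0
sum< (suc K) f = f 0 + sum< K (λ k → f (suc k))

syntax sum< K (λ k → e) = ∑[ k < K ] e

⟦_⟧ : Bool → ℕ
⟦ b ⟧ = if b then 1 else 0

sum<-cong : ∀ K {f g : ℕ → ℕ} → (∀ k → k < K → f k ≡ g k) → sum< K f ≡ sum< K g
sum<-cong zero    eq = refl
sum<-cong (suc K) eq = cong₂ _+_ (eq 0 z<s) (sum<-cong K (λ k k<K → eq (suc k) (s<s k<K)))

sum<-zero : ∀ K → ∑[ k < K ] 0 ≡ 0
sum<-zero zero    = refl
sum<-zero (suc K) = sum<-zero K

sum<-const : ∀ K c → ∑[ k < K ] c ≡ c * K
sum<-const zero    c = sym (*-zeroʳ c)
sum<-const (suc K) c = trans (cong (c +_) (sum<-const K c)) (sym (*-suc c K))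

sum<-distrib-+ : ∀ K (f g : ℕ → ℕ) → ∑[ k < K ] (f k + g k) ≡ sum< K f + sum< K g
sum<-distrib-+ zero    f g = refl
sum<-distrib-+ (suc K) f g = begin
  f 0 + g 0 + ∑[ k < K ] (f (suc k) + g (suc k))
    ≡⟨ cong (f 0 + g 0 +_) (sum<-distrib-+ K (f ∘ suc) (g ∘ suc)) ⟩
  f 0 + g 0 + (sum< K (f ∘ suc) + sum< K (g ∘ suc))
    ≡⟨ interchange (f 0) (g 0) _ _ ⟩
  f 0 + sum< K (f ∘ suc) + (g 0 + sum< K (g ∘ suc)) ∎
  where
  open ≡-Reasoning
  interchange : ∀ a b c d → a + b + (c + d) ≡ a + c + (b + d)
  interchange = solve 4 (λ a b c d → a :+ b :+ (c :+ d) := a :+ c :+ (b :+ d)) refl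

*-distribˡ-sum< : ∀ K c (f : ℕ → ℕ) → ∑[ k < K ] (c * f k) ≡ c * sum< K f
*-distribˡ-sum< zero    c f = sym (*-zeroʳ c)
*-distribˡ-sum< (suc K) c f =
  trans (cong (c * f 0 +_) (*-distribˡ-sum< K c (f ∘ suc))) (sym (*-distribˡ-+ c (f 0) _))

sum<-linear : ∀ K c (f g : ℕ → ℕ) → ∑[ k < K ] (c * f k + g k) ≡ c * sum< K f + sum< K g
sum<-linear K c f g = trans (sum<-distrib-+ K (λ k → c * f k) g) (cong (_+ sum< K g) (*-distribˡ-sum< K c f))

sum<-comm : ∀ A B (F : ℕ → ℕ → ℕ) → ∑[ x < A ] sum< B (F x) ≡ ∑[ y < B ] ∑[ x < A ] F x y
sum<-comm zero    B F = sym (sum<-zero B)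
sum<-comm (suc A) B F = trans (cong (sum< B (F 0) +_) (sum<-comm A B (F ∘ suc)))
  (sym (sum<-distrib-+ B (F 0) (λ y → ∑[ x < A ] F (suc x) y)))

sum<-mono-≤ : ∀ K {f g : ℕ → ℕ} → (∀ k → k < K → f k ≤ g k) → sum< K f ≤ sum< K g
sum<-mono-≤ zero    le = z≤n
sum<-mono-≤ (suc K) le = +-mono-≤ (le 0 z<s) (sum<-mono-≤ K (λ k k<K → le (suc k) (s<s k<K)))

sum<≡0⇒ : ∀ K (f : ℕ → ℕ) → sum< K f ≡ 0 → ∀ k → k < K → f k ≡ 0
sum<≡0⇒ (suc K) f eq zero    _         = m+n≡0⇒m≡0 (f 0) eq
sum<≡0⇒ (suc K) f eq (suc k) (s<s k<K) = sum<≡0⇒ K (f ∘ suc) (m+n≡0⇒n≡0 (f 0) eq) k k<K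

sum<-split : ∀ a b (f : ℕ → ℕ) → sum< (a + b) f ≡ sum< a f + ∑[ k < b ] f (a + k)
sum<-split zero    b f = refl
sum<-split (suc a) b f = trans (cong (f 0 +_) (sum<-split a b (f ∘ suc))) (sym (+-assoc (f 0) _ _))

sum<-truncate : ∀ d K (f : ℕ → ℕ) → d ≤ K → (∀ k → f (d + k) ≡ 0) → sum< K f ≡ sum< d f
sum<-truncate d K f d≤K vanish with m≤n⇒∃[o]m+o≡n d≤K
... | o , refl = begin
  sum< (d + o) f                   ≡⟨ sum<-split d o f ⟩
  sum< d f + ∑[ k < o ] f (d + k)  ≡⟨ cong (sum< d f +_) (trans (sum<-cong o (λ k _ → vanish k)) (sum<-zero o)) ⟩
  sum< d f + 0                     ≡⟨ +-identityʳ _ ⟩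
  sum< d f                         ∎
  where open ≡-Reasoning

sum<-last : ∀ K (f : ℕ → ℕ) → sum< (suc K) f ≡ sum< K f + f K
sum<-last zero    f = +-comm (f 0) 0
sum<-last (suc K) f = trans (cong (f 0 +_) (sum<-last K (f ∘ suc))) (sym (+-assoc (f 0) _ _))

sum<-point : ∀ K p (f : ℕ → ℕ) → (∀ k → K ≤ k → f k ≡ 0) →
             ∑[ k < K ] (if k ≡ᵇ p then f k else 0) ≡ f p
sum<-point zero    p       f vanish = sym (vanish p z≤n)
sum<-point (suc K) zero    f vanish = trans (cong (f 0 +_) (sum<-zero K)) (+-identityʳ (f 0))
sum<-point (suc K) (suc p) f vanish = sum<-point K p (f ∘ suc) (λ k K≤k → vanish (suc k) (s≤s K≤k))

sumFin-toℕ : ∀ K (f : ℕ → ℕ) → sumFin K (f ∘ toℕ) ≡ sum< K f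
sumFin-toℕ zero    f = refl
sumFin-toℕ (suc K) f = cong (f 0 +_) (sumFin-toℕ K (f ∘ suc))

sumFin-cong : ∀ K {f g : Fin K → ℕ} → (∀ k → f k ≡ g k) → sumFin K f ≡ sumFin K g
sumFin-cong zero    eq = refl
sumFin-cong (suc K) eq = cong₂ _+_ (eq Fin.zero) (sumFin-cong K (eq ∘ Fin.suc))

countFin≡sumFin : ∀ K (P : Fin K → Bool) → countFin K P ≡ sumFin K (⟦_⟧ ∘ P)
countFin≡sumFin zero    P = refl
countFin≡sumFin (suc K) P = cong (⟦ P Fin.zero ⟧ +_) (countFin≡sumFin K (P ∘ Fin.suc))

countFin-cong : ∀ K {P Q : Fin K → Bool} → (∀ k → P k ≡ Q k) → countFin K P ≡ countFin K Q
countFin-cong zero    eq = refl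
countFin-cong (suc K) eq = cong₂ _+_ (cong ⟦_⟧ (eq Fin.zero)) (countFin-cong K (eq ∘ Fin.suc))

countV-cong : ∀ m n {P Q : Fin m → Fin n → Bool} → (∀ i j → P i j ≡ Q i j) → countV m n P ≡ countV m n Q
countV-cong m n eq = sumFin-cong m (λ i → countFin-cong n (eq i))

countV-toℕ : ∀ m n (P : Fin m → Fin n → Bool) (Q : ℕ → ℕ → Bool) →
             (∀ i j → P i j ≡ Q (toℕ i) (toℕ j)) → countV m n P ≡ ∑[ x < m ] ∑[ y < n ] ⟦ Q x y ⟧
countV-toℕ m n P Q eq = begin
  sumFin m (λ i → countFin n (P i))                 ≡⟨ sumFin-cong m row ⟩
  sumFin m (λ i → ∑[ y < n ] ⟦ Q (toℕ i) y ⟧)       ≡⟨ sumFin-toℕ m (λ x → ∑[ y < n ] ⟦ Q x y ⟧) ⟩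
  ∑[ x < m ] ∑[ y < n ] ⟦ Q x y ⟧                  ∎
  where
  open ≡-Reasoning
  row : ∀ i → countFin n (P i) ≡ ∑[ y < n ] ⟦ Q (toℕ i) y ⟧
  row i = trans (countFin-cong n (eq i))
         (trans (countFin≡sumFin n _) (sumFin-toℕ n (λ y → ⟦ Q (toℕ i) y ⟧)))

sumFin-last : ∀ K (f : Fin (suc K) → ℕ) → sumFin (suc K) f ≡ sumFin K (f ∘ inject₁) + f (fromℕ K)
sumFin-last zero    f = +-comm (f Fin.zero) 0
sumFin-last (suc K) f = trans (cong (f Fin.zero +_) (sumFin-last K (f ∘ Fin.suc))) (sym (+-assoc (f Fin.zero) _ _))

sumFin-opposite : ∀ K (f : Fin K → ℕ) → sumFin K (f ∘ opposite) ≡ sumFin K f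
sumFin-opposite zero    f = refl
sumFin-opposite (suc K) f = begin
  f (fromℕ K) + sumFin K (f ∘ opposite ∘ Fin.suc)  ≡⟨ cong (f (fromℕ K) +_) (sumFin-opposite K (f ∘ inject₁)) ⟩
  f (fromℕ K) + sumFin K (f ∘ inject₁)            ≡⟨ +-comm (f (fromℕ K)) _ ⟩
  sumFin K (f ∘ inject₁) + f (fromℕ K)            ≡⟨ sumFin-last K f ⟨
  sumFin (suc K) f                                ∎
  where open ≡-Reasoning

shift : (ℕ → Bool) → ℕ → Bool
shift f zero    = false
shift f (suc x) = f x

shift-cong : ∀ {f g : ℕ → Bool} → (∀ z → f z ≡ g z) → ∀ x → shift f x ≡ shift g x
shift-cong eq zero    = refl
shift-cong eq (suc x) = eq x

T-injective : ∀ {a b} → (T a → T b) → (T b → T a) → a ≡ b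
T-injective {false} {false} _ _ = refl
T-injective {false} {true}  _ f = ⊥-elim (f _)
T-injective {true}  {false} f _ = ⊥-elim (f _)
T-injective {true}  {true}  _ _ = refl

≡ᵇ-resp-⇔ : ∀ {a b c d} → (a ≡ b → c ≡ d) → (c ≡ d → a ≡ b) → (a ≡ᵇ b) ≡ (c ≡ᵇ d)
≡ᵇ-resp-⇔ {a} {b} {c} {d} f g =
  T-injective (≡⇒≡ᵇ c d ∘ f ∘ ≡ᵇ⇒≡ a b) (≡⇒≡ᵇ a b ∘ g ∘ ≡ᵇ⇒≡ c d)

≡ᵇ-sym : ∀ a b → (a ≡ᵇ b) ≡ (b ≡ᵇ a)
≡ᵇ-sym a b = ≡ᵇ-resp-⇔ {a} {b} {b} {a} sym sym

T-∧-split : ∀ p {q} → T (p ∧ q) → T p × T q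
T-∧-split p = Equivalence.to (T-∧ {p})

∧-swap : ∀ c d e → c ∧ (d ∧ e) ≡ (c ∧ e) ∧ d
∧-swap false d     e     = refl
∧-swap true  false false = refl
∧-swap true  false true  = refl
∧-swap true  true  e     = sym (∧-identityʳ e)

⟦∧⟧≡if : ∀ b e → ⟦ b ∧ e ⟧ ≡ (if e then ⟦ b ⟧ else 0)
⟦∧⟧≡if false false = refl
⟦∧⟧≡if false true  = refl
⟦∧⟧≡if true  false = refl
⟦∧⟧≡if true  true  = refl

⟦∧∨⟧-disjoint : ∀ b e₁ e₂ → (T e₁ → T e₂ → ⊥) → ⟦ b ∧ (e₁ ∨ e₂) ⟧ ≡ ⟦ b ∧ e₁ ⟧ + ⟦ b ∧ e₂ ⟧
⟦∧∨⟧-disjoint false e₁    e₂    _ = refl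
⟦∧∨⟧-disjoint true  false e₂    _ = refl
⟦∧∨⟧-disjoint true  true  false _ = refl
⟦∧∨⟧-disjoint true  true  true  d = ⊥-elim (d _ _)

sum<-⟦∧≡ᵇ⟧ : ∀ K p (f : ℕ → Bool) → (∀ k → K ≤ k → f k ≡ false) →
             ∑[ k < K ] ⟦ f k ∧ (k ≡ᵇ p) ⟧ ≡ ⟦ f p ⟧
sum<-⟦∧≡ᵇ⟧ K p f vanish =
  trans (sum<-cong K (λ k _ → ⟦∧⟧≡if (f k) (k ≡ᵇ p))) (sum<-point K p (⟦_⟧ ∘ f) (λ k K≤k → cong ⟦_⟧ (vanish k K≤k)))

sum<-⟦∧≡ᵇ∨≡ᵇ⟧ : ∀ K p q (f : ℕ → Bool) → p ≢ q → (∀ k → K ≤ k → f k ≡ false) →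
               ∑[ k < K ] ⟦ f k ∧ ((k ≡ᵇ p) ∨ (k ≡ᵇ q)) ⟧ ≡ ⟦ f p ⟧ + ⟦ f q ⟧
sum<-⟦∧≡ᵇ∨≡ᵇ⟧ K p q f p≢q vanish = begin
  ∑[ k < K ] ⟦ f k ∧ ((k ≡ᵇ p) ∨ (k ≡ᵇ q)) ⟧
    ≡⟨ sum<-cong K (λ k _ → ⟦∧∨⟧-disjoint (f k) (k ≡ᵇ p) (k ≡ᵇ q) (distinct k)) ⟩
  ∑[ k < K ] (⟦ f k ∧ (k ≡ᵇ p) ⟧ + ⟦ f k ∧ (k ≡ᵇ q) ⟧)
    ≡⟨ sum<-distrib-+ K _ _ ⟩
  ∑[ k < K ] ⟦ f k ∧ (k ≡ᵇ p) ⟧ + ∑[ k < K ] ⟦ f k ∧ (k ≡ᵇ q) ⟧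
    ≡⟨ cong₂ _+_ (sum<-⟦∧≡ᵇ⟧ K p f vanish) (sum<-⟦∧≡ᵇ⟧ K q f vanish) ⟩
  ⟦ f p ⟧ + ⟦ f q ⟧ ∎
  where
  open ≡-Reasoning
  distinct : ∀ k → T (k ≡ᵇ p) → T (k ≡ᵇ q) → ⊥
  distinct k k≡p k≡q = p≢q (trans (sym (≡ᵇ⇒≡ k p k≡p)) (≡ᵇ⇒≡ k q k≡q))

allBelow : ℕ → (ℕ → Bool) → Bool
allBelow zero    p = true
allBelow (suc k) p = allBelow k p ∧ p k

allBelow⁻ : ∀ k p → T (allBelow k p) → ∀ x → x < k → T (p x)
allBelow⁻ (suc k) p t x x<sk with m≤n⇒m<n∨m≡n (s≤s⁻¹ x<sk)
... | inj₁ x<k  = allBelow⁻ k p (proj₁ (T-∧-split (allBelow k p) t)) x x<k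
... | inj₂ refl = proj₂ (T-∧-split (allBelow k p) t)

allBelow⁺ : ∀ k p → (∀ x → x < k → T (p x)) → T (allBelow k p)
allBelow⁺ zero    p h = _
allBelow⁺ (suc k) p h = Equivalence.from T-∧ (allBelow⁺ k p (λ x x<k → h x (m<n⇒m<1+n x<k)) , h k (n<1+n k))

T-all-∈ : ∀ {A : Set} (p : A → Bool) xs {x} → T (all p xs) → x ∈ xs → T (p x)
T-all-∈ p xs t = All.lookup (all⁺ p xs t)

next : ℕ → ℕ → ℕ
next N j = if suc j <ᵇ N then suc j else 0

prev : ℕ → ℕ → ℕ
prev N zero    = N ∸ 1
prev N (suc j) = j

next-cases : ∀ N j → j < N → (suc j < N × next N j ≡ suc j) ⊎ (suc j ≡ N × next N j ≡ 0)
next-cases N j j<N with suc j <ᵇ N in eq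
... | true  = inj₁ (<ᵇ⇒< (suc j) N (subst T (sym eq) _) , refl)
... | false = inj₂ (≤-antisym j<N (≮⇒≥ (λ lt → subst T eq (<⇒<ᵇ lt))) , refl)

next< : ∀ N j → j < N → next N j < N
next< N j j<N with next-cases N j j<N
... | inj₁ (sj<N , eq) = subst (_< N) (sym eq) sj<N
... | inj₂ (_    , eq) = subst (_< N) (sym eq) (≤-trans z<s j<N)

next-suc : ∀ N j → suc j < N → next N j ≡ suc j
next-suc N j sj<N rewrite Equivalence.to T-≡ (<⇒<ᵇ sj<N) = refl

next-last : ∀ n → next (suc n) n ≡ 0
next-last n with next-cases (suc n) n (n<1+n n)
... | inj₁ (n<n , _) = ⊥-elim (n≮n (suc n) n<n)
... | inj₂ (_ , eq)  = eq

prev< : ∀ N j → j < N → prev N j < N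
prev< (suc N) zero    _   = n<1+n N
prev< N       (suc j) j<N = <-trans (n<1+n j) j<N

next-prev : ∀ N j → j < N → next N (prev N j) ≡ j
next-prev (suc N) zero    _   with next-cases (suc N) N (n<1+n N)
... | inj₁ (N<N , _) = ⊥-elim (n≮n (suc N) N<N)
... | inj₂ (_ , eq)  = eq
next-prev N       (suc j) j<N with next-cases N j (<-trans (n<1+n j) j<N)
... | inj₁ (_ , eq)  = eq
... | inj₂ (eq , _)  = ⊥-elim (<-irrefl eq j<N)

prev-next : ∀ N j → j < N → prev N (next N j) ≡ j
prev-next N j j<N with next-cases N j j<N
... | inj₁ (_ , eq)   rewrite eq = refl
... | inj₂ (sj≡N , eq) rewrite eq | sym sj≡N = refl

next≢prev : ∀ N j → 3 ≤ N → j < N → next N j ≢ prev N j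
next≢prev (suc (suc (suc k))) zero _ _ ()
next≢prev 1 zero (s≤s ()) _
next≢prev 2 zero (s≤s (s≤s ())) _
next≢prev N (suc j) 3≤N j<N eq with next-cases N (suc j) j<N
... | inj₁ (_ , e)     = <⇒≢ (m<n⇒m<1+n (n<1+n j)) (sym (trans (sym e) eq))
... | inj₂ (ssj≡N , e) = <⇒≱ 3≤N (≤-reflexive (trans (sym ssj≡N) (cong (suc ∘ suc) (sym (trans (sym e) eq)))))

%-suc≡next : ∀ n j → j < suc n → (j + 1) % suc n ≡ next (suc n) j
%-suc≡next n j j<N rewrite +-comm j 1 with next-cases (suc n) j j<N
... | inj₁ (sj<N , eq)  rewrite eq = m<n⇒m%n≡m sj<N
... | inj₂ (sj≡N , eq) rewrite eq | sj≡N = n%n≡0 (suc n)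

sum<-prev : ∀ n (f : ℕ → ℕ) → ∑[ y < suc n ] f (prev (suc n) y) ≡ sum< (suc n) f
sum<-prev n f = trans (+-comm (f n) (sum< n f)) (sym (sum<-last n f))

sum<-+prev : ∀ n (f g : ℕ → ℕ) → ∑[ y < suc n ] (f y + g (prev (suc n) y)) ≡ sum< (suc n) f + sum< (suc n) g
sum<-+prev n f g = trans (sum<-distrib-+ (suc n) f (g ∘ prev (suc n))) (cong (sum< (suc n) f +_) (sum<-prev n g))

telescope-≤ : ∀ N (a b g : ℕ → ℕ) → (∀ y → y < N → a y + g y ≤ b y + g (prev N y)) → sum< N a ≤ sum< N b
telescope-≤ zero    a b g _    = z≤n
telescope-≤ (suc n) a b g step = +-cancelʳ-≤ (sum< (suc n) g) (sum< (suc n) a) (sum< (suc n) b) (begin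
  sum< (suc n) a + sum< (suc n) g            ≡⟨ sum<-distrib-+ (suc n) a g ⟨
  ∑[ y < suc n ] (a y + g y)                 ≤⟨ sum<-mono-≤ (suc n) step ⟩
  ∑[ y < suc n ] (b y + g (prev (suc n) y))  ≡⟨ sum<-+prev n b g ⟩
  sum< (suc n) b + sum< (suc n) g            ∎)
  where open ≤-Reasoning

telescope-≡ : ∀ N (a b g : ℕ → ℕ) → (∀ y → y < N → a y + g y ≡ b y + g (prev N y)) → sum< N a ≡ sum< N b
telescope-≡ zero    a b g _    = refl
telescope-≡ (suc n) a b g step = +-cancelʳ-≡ (sum< (suc n) g) (sum< (suc n) a) (sum< (suc n) b) (begin
  sum< (suc n) a + sum< (suc n) g            ≡⟨ sum<-distrib-+ (suc n) a g ⟨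
  ∑[ y < suc n ] (a y + g y)                 ≡⟨ sum<-cong (suc n) step ⟩
  ∑[ y < suc n ] (b y + g (prev (suc n) y))  ≡⟨ sum<-+prev n b g ⟩
  sum< (suc n) b + sum< (suc n) g            ∎)
  where open ≡-Reasoning

cell : ∀ {m n} → VSet m n → ℕ → ℕ → Bool
cell {m} {n} R x y with x <? m | y <? n
... | yes x<m | yes y<n = R (fromℕ< x<m) (fromℕ< y<n)
... | _       | _       = false

module _ {m n} (R : VSet m n) where

  cell-fromℕ< : ∀ {x y} (x<m : x < m) (y<n : y < n) → cell R x y ≡ R (fromℕ< x<m) (fromℕ< y<n)
  cell-fromℕ< {x} {y} x<m y<n with x <? m | y <? n
  ... | yes _   | yes _   = refl
  ... | no x≮m  | _       = ⊥-elim (x≮m x<m)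
  ... | yes _   | no y≮n  = ⊥-elim (y≮n y<n)

  cell-toℕ : ∀ i j → cell R (toℕ i) (toℕ j) ≡ R i j
  cell-toℕ i j = trans (cell-fromℕ< (toℕ<n i) (toℕ<n j)) (cong₂ R (fromℕ<-toℕ i _) (fromℕ<-toℕ j _))

  cell-row-≥ : ∀ {x} y → m ≤ x → cell R x y ≡ false
  cell-row-≥ {x} y m≤x with x <? m | y <? n
  ... | yes x<m | yes _ = ⊥-elim (<⇒≱ x<m m≤x)
  ... | yes _   | no _  = refl
  ... | no _    | _     = refl

  cell-col-≥ : ∀ x {y} → n ≤ y → cell R x y ≡ false
  cell-col-≥ x {y} n≤y with x <? m | y <? n
  ... | yes _ | yes y<n = ⊥-elim (<⇒≱ y<n n≤y)
  ... | yes _ | no _    = refl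
  ... | no _  | _       = refl

-- cycleAdj {suc n} and pathAdj of Defs, read on the indices toℕ j, toℕ j′ (definitionally).
cycleAdjℕ : ℕ → ℕ → ℕ → Bool
cycleAdjℕ n y y' = (((y + 1) % suc n) ≡ᵇ y') ∨ (((y' + 1) % suc n) ≡ᵇ y)

pathAdjℕ : ℕ → ℕ → Bool
pathAdjℕ x x' = ((x + 1) ≡ᵇ x') ∨ ((x' + 1) ≡ᵇ x)

cycleAdj-spec : ∀ n y y' → y < suc n → y' < suc n →
                cycleAdjℕ n y y' ≡ (y' ≡ᵇ next (suc n) y) ∨ (y' ≡ᵇ prev (suc n) y)
cycleAdj-spec n y y' y<N y'<N = cong₂ _∨_
  (trans (cong (_≡ᵇ y') (%-suc≡next n y y<N)) (≡ᵇ-sym (next (suc n) y) y'))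
  (trans (cong (_≡ᵇ y) (%-suc≡next n y' y'<N)) (≡ᵇ-resp-⇔
    (λ e → trans (sym (prev-next (suc n) y' y'<N)) (cong (prev (suc n)) e))
    (λ e → trans (cong (next (suc n)) e) (next-prev (suc n) y y<N))))

pathAdj-spec : ∀ x x' → pathAdjℕ x x' ≡ (x' ≡ᵇ suc x) ∨ shift (x' ≡ᵇ_) x
pathAdj-spec x x' = cong₂ _∨_ (trans (cong (_≡ᵇ x') (+-comm x 1)) (≡ᵇ-sym (suc x) x')) (below x)
  where
  below : ∀ x → ((x' + 1) ≡ᵇ x) ≡ shift (x' ≡ᵇ_) x
  below zero    rewrite +-comm x' 1 = refl
  below (suc x) rewrite +-comm x' 1 = refl

localNbrs : ∀ {m n} → VSet m n → ℕ → ℕ → ℕ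
localNbrs {n = n} R x y =
  ⟦ shift (λ z → cell R z y) x ⟧ + ⟦ cell R (suc x) y ⟧ + ⟦ cell R x (prev n y) ⟧ + ⟦ cell R x (next n y) ⟧

module _ {m n} (R : VSet m (suc n)) (3≤N : 3 ≤ suc n) where
  private
    N : ℕ
    N = suc n
    c : ℕ → ℕ → Bool
    c = cell R

  horizontalNbrs : ∀ x y → y < N →
    ∑[ x' < m ] ∑[ y' < N ] ⟦ c x' y' ∧ ((x ≡ᵇ x') ∧ cycleAdjℕ n y y') ⟧ ≡ ⟦ c x (next N y) ⟧ + ⟦ c x (prev N y) ⟧
  horizontalNbrs x y y<N = begin
    ∑[ x' < m ] ∑[ y' < N ] ⟦ c x' y' ∧ ((x ≡ᵇ x') ∧ cyc y') ⟧
      ≡⟨ sum<-cong m (λ x' _ → sum<-cong N (λ y' _ → cong ⟦_⟧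
           (trans (∧-swap (c x' y') (x ≡ᵇ x') (cyc y')) (cong ((c x' y' ∧ cyc y') ∧_) (≡ᵇ-sym x x'))))) ⟩
    ∑[ x' < m ] ∑[ y' < N ] ⟦ (c x' y' ∧ cyc y') ∧ (x' ≡ᵇ x) ⟧
      ≡⟨ sum<-comm m N (λ x' y' → ⟦ (c x' y' ∧ cyc y') ∧ (x' ≡ᵇ x) ⟧) ⟩
    ∑[ y' < N ] ∑[ x' < m ] ⟦ (c x' y' ∧ cyc y') ∧ (x' ≡ᵇ x) ⟧
      ≡⟨ sum<-cong N (λ y' _ → sum<-⟦∧≡ᵇ⟧ m x (λ x' → c x' y' ∧ cyc y')
           (λ x' m≤x' → cong (_∧ cyc y') (cell-row-≥ R y' m≤x'))) ⟩
    ∑[ y' < N ] ⟦ c x y' ∧ cyc y' ⟧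
      ≡⟨ sum<-cong N (λ y' y'<N → cong (λ b → ⟦ c x y' ∧ b ⟧) (cycleAdj-spec n y y' y<N y'<N)) ⟩
    ∑[ y' < N ] ⟦ c x y' ∧ ((y' ≡ᵇ next N y) ∨ (y' ≡ᵇ prev N y)) ⟧
      ≡⟨ sum<-⟦∧≡ᵇ∨≡ᵇ⟧ N _ _ (c x) (next≢prev N y 3≤N y<N) (λ y' N≤y' → cell-col-≥ R x N≤y') ⟩
    ⟦ c x (next N y) ⟧ + ⟦ c x (prev N y) ⟧ ∎
    where
    open ≡-Reasoning
    cyc : ℕ → Bool
    cyc = cycleAdjℕ n y

  verticalNbrs : ∀ x y →
    ∑[ x' < m ] ∑[ y' < N ] ⟦ c x' y' ∧ (pathAdjℕ x x' ∧ (y ≡ᵇ y')) ⟧ ≡ ⟦ c (suc x) y ⟧ + ⟦ shift (λ z → c z y) x ⟧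
  verticalNbrs x y = begin
    ∑[ x' < m ] ∑[ y' < N ] ⟦ c x' y' ∧ (path x' ∧ (y ≡ᵇ y')) ⟧
      ≡⟨ sum<-cong m (λ x' _ → sum<-cong N (λ y' _ → cong ⟦_⟧
           (trans (sym (∧-assoc (c x' y') (path x') (y ≡ᵇ y'))) (cong ((c x' y' ∧ path x') ∧_) (≡ᵇ-sym y y'))))) ⟩
    ∑[ x' < m ] ∑[ y' < N ] ⟦ (c x' y' ∧ path x') ∧ (y' ≡ᵇ y) ⟧
      ≡⟨ sum<-cong m (λ x' _ → sum<-⟦∧≡ᵇ⟧ N y (λ y' → c x' y' ∧ path x')
           (λ y' N≤y' → cong (_∧ path x') (cell-col-≥ R x' N≤y'))) ⟩
    ∑[ x' < m ] ⟦ c x' y ∧ path x' ⟧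
      ≡⟨ sum<-cong m (λ x' _ → cong (λ b → ⟦ c x' y ∧ b ⟧) (pathAdj-spec x x')) ⟩
    ∑[ x' < m ] ⟦ c x' y ∧ ((x' ≡ᵇ suc x) ∨ shift (x' ≡ᵇ_) x) ⟧
      ≡⟨ above-below x ⟩
    ⟦ c (suc x) y ⟧ + ⟦ shift (λ z → c z y) x ⟧ ∎
    where
    open ≡-Reasoning
    path : ℕ → Bool
    path = pathAdjℕ x
    vanish : ∀ x' → m ≤ x' → c x' y ≡ false
    vanish x' m≤x' = cell-row-≥ R y m≤x'
    above-below : ∀ x → ∑[ x' < m ] ⟦ c x' y ∧ ((x' ≡ᵇ suc x) ∨ shift (x' ≡ᵇ_) x) ⟧
                          ≡ ⟦ c (suc x) y ⟧ + ⟦ shift (λ z → c z y) x ⟧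
    above-below zero = trans (sum<-cong m (λ x' _ → cong (λ b → ⟦ c x' y ∧ b ⟧) (∨-identityʳ (x' ≡ᵇ 1))))
                             (trans (sum<-⟦∧≡ᵇ⟧ m 1 (λ x' → c x' y) vanish) (sym (+-identityʳ _)))
    above-below (suc x) = sum<-⟦∧≡ᵇ∨≡ᵇ⟧ m (suc (suc x)) x (λ x' → c x' y) (λ ()) vanish

  nbrsIn≡localNbrs : ∀ i j → nbrsIn R i j ≡ localNbrs R (toℕ i) (toℕ j)
  nbrsIn≡localNbrs i j = begin
    nbrsIn R i j
      ≡⟨ countV-toℕ m N _ (λ x' y' → c x' y' ∧ (H x' y' ∨ V x' y'))
           (λ i' j' → cong (_∧ adj i j i' j') (sym (cell-toℕ R i' j'))) ⟩
    ∑[ x' < m ] ∑[ y' < N ] ⟦ c x' y' ∧ (H x' y' ∨ V x' y') ⟧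
      ≡⟨ sum<-cong m (λ x' _ → trans
           (sum<-cong N (λ y' _ → ⟦∧∨⟧-disjoint (c x' y') (H x' y') (V x' y') (disjoint x' y')))
           (sum<-distrib-+ N (λ y' → ⟦ c x' y' ∧ H x' y' ⟧) (λ y' → ⟦ c x' y' ∧ V x' y' ⟧))) ⟩
    ∑[ x' < m ] (∑[ y' < N ] ⟦ c x' y' ∧ H x' y' ⟧ + ∑[ y' < N ] ⟦ c x' y' ∧ V x' y' ⟧)
      ≡⟨ sum<-distrib-+ m (λ x' → ∑[ y' < N ] ⟦ c x' y' ∧ H x' y' ⟧) (λ x' → ∑[ y' < N ] ⟦ c x' y' ∧ V x' y' ⟧) ⟩
    ∑[ x' < m ] ∑[ y' < N ] ⟦ c x' y' ∧ H x' y' ⟧ + ∑[ x' < m ] ∑[ y' < N ] ⟦ c x' y' ∧ V x' y' ⟧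
      ≡⟨ cong₂ _+_ (horizontalNbrs x y (toℕ<n j)) (verticalNbrs x y) ⟩
    (⟦ c x (next N y) ⟧ + ⟦ c x (prev N y) ⟧) + (⟦ c (suc x) y ⟧ + ⟦ shift (λ z → c z y) x ⟧)
      ≡⟨ reverse4 ⟦ c x (next N y) ⟧ ⟦ c x (prev N y) ⟧ ⟦ c (suc x) y ⟧ ⟦ shift (λ z → c z y) x ⟧ ⟩
    localNbrs R x y ∎
    where
    open ≡-Reasoning
    x y : ℕ
    x = toℕ i
    y = toℕ j
    H V : ℕ → ℕ → Bool
    H x' y' = (x ≡ᵇ x') ∧ cycleAdjℕ n y y'
    V x' y' = pathAdjℕ x x' ∧ (y ≡ᵇ y')
    disjoint : ∀ x' y' → T (H x' y') → T (V x' y') → ⊥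
    disjoint x' y' h v = path-irrefl (subst (T ∘ pathAdjℕ x) (sym x≡x') (proj₁ (T-∧-split (pathAdjℕ x x') v)))
      where
      x≡x' : x ≡ x'
      x≡x' = ≡ᵇ⇒≡ x x' (proj₁ (T-∧-split (x ≡ᵇ x') h))
      path-irrefl : T (pathAdjℕ x x) → ⊥
      path-irrefl t = 1+n≢n (trans (+-comm 1 x) (≡ᵇ⇒≡ (x + 1) x (reduce (Equivalence.to T-∨ t))))
    reverse4 : ∀ a b c d → (a + b) + (c + d) ≡ d + c + b + a
    reverse4 = solve 4 (λ a b c d → (a :+ b) :+ (c :+ d) := d :+ c :+ b :+ a) refl

-- Reflecting the rows

flipRows : ∀ {m n} → VSet m n → VSet m n
flipRows R i j = R (opposite i) j

countV-flipRows : ∀ m n (P : VSet m n) → countV m n (flipRows P) ≡ countV m n P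
countV-flipRows m n P = sumFin-opposite m (λ i → countFin n (P i))

suc[m∸suc[k]]≡m∸k : ∀ {m k} → k < m → suc (m ∸ suc k) ≡ m ∸ k
suc[m∸suc[k]]≡m∸k {m} k<m = sym (+-∸-assoc 1 k<m)

module _ {m n} (R : VSet m n) where

  cell-flipRows : ∀ {x} y → x < m → cell (flipRows R) x y ≡ cell R (m ∸ suc x) y
  cell-flipRows {x} y x<m = by-column (y <? n)
    where
    open ≡-Reasoning
    by-column : Dec (y < n) → cell (flipRows R) x y ≡ cell R (m ∸ suc x) y
    by-column (no y≮n)  = trans (cell-col-≥ (flipRows R) x (≮⇒≥ y≮n)) (sym (cell-col-≥ R _ (≮⇒≥ y≮n)))
    by-column (yes y<n) = begin
      cell (flipRows R) x y                                     ≡⟨ cell-fromℕ< (flipRows R) x<m y<n ⟩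
      R (opposite (fromℕ< x<m)) (fromℕ< y<n)                    ≡⟨ cell-toℕ R _ _ ⟨
      cell R (toℕ (opposite (fromℕ< x<m))) (toℕ (fromℕ< y<n))  ≡⟨ cong₂ (cell R) opposite-x (toℕ-fromℕ< y<n) ⟩
      cell R (m ∸ suc x) y                                      ∎
      where
      opposite-x : toℕ (opposite (fromℕ< x<m)) ≡ m ∸ suc x
      opposite-x = trans (opposite-prop (fromℕ< x<m)) (cong (λ z → m ∸ suc z) (toℕ-fromℕ< x<m))

  localNbrs-flipRows : ∀ x y → x < m → localNbrs (flipRows R) x y ≡ localNbrs R (m ∸ suc x) y
  localNbrs-flipRows x y x<m =
    cong₂ _+_ (cong₂ _+_ vertical (cong ⟦_⟧ (cell-flipRows _ x<m))) (cong ⟦_⟧ (cell-flipRows _ x<m))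
    where
    below : ∀ x → x < m → shift (λ z → cell (flipRows R) z y) x ≡ cell R (suc (m ∸ suc x)) y
    below zero    0<m  = sym (cell-row-≥ R y (≤-reflexive (sym (suc[m∸suc[k]]≡m∸k 0<m))))
    below (suc x) sx<m = trans (cell-flipRows y (<-trans (n<1+n x) sx<m))
                               (cong (λ z → cell R z y) (sym (suc[m∸suc[k]]≡m∸k sx<m)))
    above : x < m → cell (flipRows R) (suc x) y ≡ shift (λ z → cell R z y) (m ∸ suc x)
    above x<m = by-row (suc x <? m)
      where
      by-row : Dec (suc x < m) → cell (flipRows R) (suc x) y ≡ shift (λ z → cell R z y) (m ∸ suc x)
      by-row (yes sx<m) = trans (cell-flipRows y sx<m) (cong (shift (λ z → cell R z y)) (suc[m∸suc[k]]≡m∸k sx<m))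
      by-row (no sx≮m)  = trans (cell-row-≥ (flipRows R) y (≮⇒≥ sx≮m))
                                (cong (shift (λ z → cell R z y)) (sym (trans (cong (_∸ suc x) m≡sx) (n∸n≡0 (suc x)))))
        where
        m≡sx : m ≡ suc x
        m≡sx = ≤-antisym (≮⇒≥ sx≮m) x<m
    vertical : ⟦ shift (λ z → cell (flipRows R) z y) x ⟧ + ⟦ cell (flipRows R) (suc x) y ⟧
             ≡ ⟦ shift (λ z → cell R z y) (m ∸ suc x) ⟧ + ⟦ cell R (suc (m ∸ suc x)) y ⟧
    vertical = trans (cong₂ _+_ (cong ⟦_⟧ (below x x<m)) (cong ⟦_⟧ (above x<m)))
                     (+-comm ⟦ cell R (suc (m ∸ suc x)) y ⟧ _)

module _ {m n} (R : VSet m (suc n)) (3≤N : 3 ≤ suc n) where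

  nbrsIn-flipRows : ∀ i j → nbrsIn (flipRows R) i j ≡ nbrsIn R (opposite i) j
  nbrsIn-flipRows i j = begin
    nbrsIn (flipRows R) i j                 ≡⟨ nbrsIn≡localNbrs (flipRows R) 3≤N i j ⟩
    localNbrs (flipRows R) (toℕ i) (toℕ j)  ≡⟨ localNbrs-flipRows R _ _ (toℕ<n i) ⟩
    localNbrs R (m ∸ suc (toℕ i)) (toℕ j)   ≡⟨ cong (λ x → localNbrs R x (toℕ j)) (opposite-prop i) ⟨
    localNbrs R (toℕ (opposite i)) (toℕ j)  ≡⟨ nbrsIn≡localNbrs R 3≤N (opposite i) j ⟨
    nbrsIn R (opposite i) j                 ∎
    where open ≡-Reasoning

  ω₂-flipRows : ω₂ (flipRows R) ≡ ω₂ R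
  ω₂-flipRows = cong₂ (λ r ab → ℤ.+ (4 * r) ℤ.- ℤ.+ ab) (countV-flipRows m (suc n) R)
    (cong₂ (λ a b → 2 * a + b)
      (trans (countV-cong m (suc n) (λ i j → cong (λ k → not (R (opposite i) j) ∧ not (k ≡ᵇ 0) ∧ not (k ≡ᵇ 1))
                                                  (nbrsIn-flipRows i j)))
             (countV-flipRows m (suc n) (inA R)))
      (trans (countV-cong m (suc n) (λ i j → cong (λ k → not (R (opposite i) j) ∧ (k ≡ᵇ 1)) (nbrsIn-flipRows i j)))
             (countV-flipRows m (suc n) (inB R))))

  flipRows-Border2DomV3 : 6 ≤ m → Border2DomV3 R → Border2DomV1 (flipRows R)
  flipRows-Border2DomV3 6≤m (inV₃ , dom₂ , dom₁) = inV₁ , dom₂′ , dom₁′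
    where
    inV₁ : ∀ i j → flipRows R i j ≡ true → toℕ i < 5
    inV₁ i j r = ≰⇒> λ 5≤i → n≮n (m ∸ 5) (begin-strict
      m ∸ 5                ≤⟨ subst (m ∸ 5 ≤_) (opposite-prop i) (inV₃ (opposite i) j r) ⟩
      m ∸ suc (toℕ i)      ≤⟨ ∸-monoʳ-≤ m (s≤s 5≤i) ⟩
      m ∸ 6                <⟨ n<1+n (m ∸ 6) ⟩
      suc (m ∸ 6)          ≡⟨ suc[m∸suc[k]]≡m∸k 6≤m ⟩
      m ∸ 5                ∎)
      where open ≤-Reasoning
    dom₂′ : ∀ i j → toℕ i < 4 → flipRows R i j ≡ false → 2 ≤ nbrsIn (flipRows R) i j
    dom₂′ i j i<4 r = subst (2 ≤_) (sym (nbrsIn-flipRows i j))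
      (dom₂ (opposite i) j (subst (m ∸ 4 ≤_) (sym (opposite-prop i)) (∸-monoʳ-≤ m i<4)) r)
    dom₁′ : ∀ i j → toℕ i ≡ 4 → flipRows R i j ≡ false → 1 ≤ nbrsIn (flipRows R) i j
    dom₁′ i j i≡4 r = subst (1 ≤_) (sym (nbrsIn-flipRows i j))
      (dom₁ (opposite i) j (trans (opposite-prop i) (cong (λ z → m ∸ suc z) i≡4)) r)

record Column : Set where
  constructor col
  field row₀ row₁ row₂ row₃ row₄ : Bool

bit : Column → ℕ → Bool
bit c 0 = Column.row₀ c
bit c 1 = Column.row₁ c
bit c 2 = Column.row₂ c
bit c 3 = Column.row₃ c
bit c 4 = Column.row₄ c
bit c (suc (suc (suc (suc (suc _))))) = false

columnNbrs : ℕ → Column → Column → Column → ℕ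
columnNbrs x a b c = ⟦ shift (bit b) x ⟧ + ⟦ bit b (suc x) ⟧ + ⟦ bit a x ⟧ + ⟦ bit c x ⟧

-- Row 5 lies outside V₁, but its vertices still receive from row 4.
received : Column → Column → Column → ℕ
received a b c = ∑[ x < 6 ] (if bit b x then 0 else 2 ⊓ columnNbrs x a b c)

sent : Column → ℕ
sent b = 4 * ∑[ x < 5 ] ⟦ bit b x ⟧

dominated : ℕ → ℕ → Column → Column → Column → Bool
dominated k x a b c = bit b x ∨ (k ≤ᵇ columnNbrs x a b c)

feasible : Column → Column → Column → Bool
feasible a b c = allBelow 4 (λ x → dominated 2 x a b c) ∧ dominated 1 4 a b c

feasible-intro : ∀ a b c → (∀ x → x < 4 → T (dominated 2 x a b c)) → T (dominated 1 4 a b c) →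
                 T (feasible a b c)
feasible-intro a b c d₂ d₁ = Equivalence.from T-∧ (allBelow⁺ 4 (λ x → dominated 2 x a b c) d₂ , d₁)

feasible⇒dominated₂ : ∀ a b c → T (feasible a b c) → ∀ x → x < 4 → T (dominated 2 x a b c)
feasible⇒dominated₂ a b c t =
  allBelow⁻ 4 (λ x → dominated 2 x a b c) (proj₁ (T-∧-split (allBelow 4 (λ x → dominated 2 x a b c)) t))

feasible⇒dominated₁ : ∀ a b c → T (feasible a b c) → T (dominated 1 4 a b c)
feasible⇒dominated₁ a b c t = proj₂ (T-∧-split (allBelow 4 (λ x → dominated 2 x a b c)) t)

bit≡true⇒<5 : ∀ c x → bit c x ≡ true → x < 5
bit≡true⇒<5 c 0 _ = s≤s z≤n
bit≡true⇒<5 c 1 _ = s≤s (s≤s z≤n)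
bit≡true⇒<5 c 2 _ = s≤s (s≤s (s≤s z≤n))
bit≡true⇒<5 c 3 _ = s≤s (s≤s (s≤s (s≤s z≤n)))
bit≡true⇒<5 c 4 _ = s≤s (s≤s (s≤s (s≤s (s≤s z≤n))))

column : ∀ {m n} → VSet m n → ℕ → Column
column R y = col (cell R 0 y) (cell R 1 y) (cell R 2 y) (cell R 3 y) (cell R 4 y)

totalSent : ℕ → (ℕ → Column) → ℕ
totalSent N w = ∑[ y < N ] sent (w y)

totalReceived : ℕ → (ℕ → Column) → ℕ
totalReceived N w = ∑[ y < N ] received (w (prev N y)) (w y) (w (next N y))

FeasibleWord : ℕ → (ℕ → Column) → Set
FeasibleWord N w = ∀ y → y < N → T (feasible (w (prev N y)) (w y) (w (next N y)))

FeasibleWord-cong : ∀ N {u v : ℕ → Column} → (∀ y → y < N → u y ≡ v y) → FeasibleWord N u → FeasibleWord N v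
FeasibleWord-cong N {u} {v} eq feasibleU y y<N =
  subst T (cong₂ (λ a bc → feasible a (proj₁ bc) (proj₂ bc)) (eq (prev N y) (prev< N y y<N))
                 (cong₂ _,_ (eq y y<N) (eq (next N y) (next< N y y<N))))
        (feasibleU y y<N)

totalSent-cong : ∀ N {u v : ℕ → Column} → (∀ y → y < N → u y ≡ v y) → totalSent N u ≡ totalSent N v
totalSent-cong N eq = sum<-cong N (λ y y<N → cong sent (eq y y<N))

totalReceived-cong : ∀ N {u v : ℕ → Column} → (∀ y → y < N → u y ≡ v y) → totalReceived N u ≡ totalReceived N v
totalReceived-cong N eq = sum<-cong N (λ y y<N →
  cong₂ (λ a bc → received a (proj₁ bc) (proj₂ bc)) (eq (prev N y) (prev< N y y<N))
        (cong₂ _,_ (eq y y<N) (eq (next N y) (next< N y y<N))))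

column≡ : ∀ {m n} (R : VSet m n) y c → (∀ x → x < 5 → cell R x y ≡ bit c x) → column R y ≡ c
column≡ R y c eq rewrite eq 0 (s≤s z≤n) | eq 1 (s≤s (s≤s z≤n)) | eq 2 (s≤s (s≤s (s≤s z≤n)))
                       | eq 3 (s≤s (s≤s (s≤s (s≤s z≤n)))) | eq 4 (s≤s (s≤s (s≤s (s≤s (s≤s z≤n))))) = refl

2⟦A⟧+⟦B⟧ : ∀ r k → 2 * ⟦ not r ∧ not (k ≡ᵇ 0) ∧ not (k ≡ᵇ 1) ⟧ + ⟦ not r ∧ (k ≡ᵇ 1) ⟧ ≡ (if r then 0 else 2 ⊓ k)
2⟦A⟧+⟦B⟧ true  k             = refl
2⟦A⟧+⟦B⟧ false zero          = refl
2⟦A⟧+⟦B⟧ false (suc zero)    = refl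
2⟦A⟧+⟦B⟧ false (suc (suc k)) = refl

module Columns {m n} (R : VSet m (suc n)) (3≤N : 3 ≤ suc n) (6≤m : 6 ≤ m)
               (inV₁ : ∀ i j → R i j ≡ true → toℕ i < 5) where
  private
    N : ℕ
    N = suc n
    w : ℕ → Column
    w = column R

  cell-row-≥5 : ∀ k y → cell R (5 + k) y ≡ false
  cell-row-≥5 k y = by-cases (5 + k <? m) (y <? N)
    where
    by-cases : Dec (5 + k < m) → Dec (y < N) → cell R (5 + k) y ≡ false
    by-cases (no ≮m)  _          = cell-row-≥ R y (≮⇒≥ ≮m)
    by-cases (yes _)  (no y≮N)   = cell-col-≥ R (5 + k) (≮⇒≥ y≮N)
    by-cases (yes <m) (yes y<N) with R (fromℕ< <m) (fromℕ< y<N) in r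
    ... | false = trans (cell-fromℕ< R <m y<N) r
    ... | true  = ⊥-elim (<⇒≱ (subst (_< 5) (toℕ-fromℕ< <m) (inV₁ _ _ r)) (m≤m+n 5 k))

  cell≡bit : ∀ x y → cell R x y ≡ bit (w y) x
  cell≡bit 0 y = refl
  cell≡bit 1 y = refl
  cell≡bit 2 y = refl
  cell≡bit 3 y = refl
  cell≡bit 4 y = refl
  cell≡bit (suc (suc (suc (suc (suc k))))) y = cell-row-≥5 k y

  localNbrs≡columnNbrs : ∀ x y → localNbrs R x y ≡ columnNbrs x (w (prev N y)) (w y) (w (next N y))
  localNbrs≡columnNbrs x y =
    cong₂ _+_ (cong₂ _+_ (cong₂ _+_ (cong ⟦_⟧ (shift-cong (λ z → cell≡bit z y) x))
                                    (cong ⟦_⟧ (cell≡bit (suc x) y)))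
                         (cong ⟦_⟧ (cell≡bit x (prev N y))))
              (cong ⟦_⟧ (cell≡bit x (next N y)))

  4*count≡totalSent : 4 * countV m N R ≡ totalSent N w
  4*count≡totalSent = begin
    4 * countV m N R
      ≡⟨ cong (4 *_) (countV-toℕ m N R (cell R) (λ i j → sym (cell-toℕ R i j))) ⟩
    4 * ∑[ x < m ] ∑[ y < N ] ⟦ cell R x y ⟧
      ≡⟨ cong (4 *_) (sum<-comm m N (λ x y → ⟦ cell R x y ⟧)) ⟩
    4 * ∑[ y < N ] ∑[ x < m ] ⟦ cell R x y ⟧
      ≡⟨ cong (4 *_) (sum<-cong N (λ y _ → column-count y)) ⟩
    4 * ∑[ y < N ] ∑[ x < 5 ] ⟦ bit (w y) x ⟧
      ≡⟨ *-distribˡ-sum< N 4 (λ y → ∑[ x < 5 ] ⟦ bit (w y) x ⟧) ⟨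
    totalSent N w ∎
    where
    open ≡-Reasoning
    column-count : ∀ y → ∑[ x < m ] ⟦ cell R x y ⟧ ≡ ∑[ x < 5 ] ⟦ bit (w y) x ⟧
    column-count y = trans (sum<-cong m (λ x _ → cong ⟦_⟧ (cell≡bit x y)))
                           (sum<-truncate 5 m (λ x → ⟦ bit (w y) x ⟧) (≤-trans (n≤1+n 5) 6≤m) (λ _ → refl))

  2*|A|+|B|≡totalReceived : 2 * countV m N (inA R) + countV m N (inB R) ≡ totalReceived N w
  2*|A|+|B|≡totalReceived = begin
    2 * countV m N (inA R) + countV m N (inB R)
      ≡⟨ cong₂ (λ a b → 2 * a + b) |A| |B| ⟩
    2 * ∑[ x < m ] ∑[ y < N ] ⟦ A x y ⟧ + ∑[ x < m ] ∑[ y < N ] ⟦ B x y ⟧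
      ≡⟨ trans (sum<-cong m (λ x _ → sum<-linear N 2 (λ y → ⟦ A x y ⟧) (λ y → ⟦ B x y ⟧)))
               (sum<-linear m 2 (λ x → ∑[ y < N ] ⟦ A x y ⟧) (λ x → ∑[ y < N ] ⟦ B x y ⟧)) ⟨
    ∑[ x < m ] ∑[ y < N ] (2 * ⟦ A x y ⟧ + ⟦ B x y ⟧)
      ≡⟨ sum<-cong m (λ x _ → sum<-cong N (λ y _ → 2⟦A⟧+⟦B⟧ (cell R x y) (localNbrs R x y))) ⟩
    ∑[ x < m ] ∑[ y < N ] received′ x y
      ≡⟨ sum<-comm m N received′ ⟩
    ∑[ y < N ] ∑[ x < m ] received′ x y
      ≡⟨ sum<-cong N (λ y _ → column-received y) ⟩
    totalReceived N w ∎
    where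
    open ≡-Reasoning
    A B : ℕ → ℕ → Bool
    A x y = not (cell R x y) ∧ not (localNbrs R x y ≡ᵇ 0) ∧ not (localNbrs R x y ≡ᵇ 1)
    B x y = not (cell R x y) ∧ (localNbrs R x y ≡ᵇ 1)
    received′ : ℕ → ℕ → ℕ
    received′ x y = if cell R x y then 0 else 2 ⊓ localNbrs R x y
    |A| : countV m N (inA R) ≡ ∑[ x < m ] ∑[ y < N ] ⟦ A x y ⟧
    |A| = countV-toℕ m N (inA R) A λ i j →
      cong₂ (λ r k → not r ∧ not (k ≡ᵇ 0) ∧ not (k ≡ᵇ 1)) (sym (cell-toℕ R i j)) (nbrsIn≡localNbrs R 3≤N i j)
    |B| : countV m N (inB R) ≡ ∑[ x < m ] ∑[ y < N ] ⟦ B x y ⟧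
    |B| = countV-toℕ m N (inB R) B λ i j →
      cong₂ (λ r k → not r ∧ (k ≡ᵇ 1)) (sym (cell-toℕ R i j)) (nbrsIn≡localNbrs R 3≤N i j)
    column-received : ∀ y → ∑[ x < m ] received′ x y ≡ received (w (prev N y)) (w y) (w (next N y))
    column-received y =
      trans (sum<-cong m (λ x _ → cong₂ (λ r k → if r then 0 else 2 ⊓ k) (cell≡bit x y) (localNbrs≡columnNbrs x y)))
            (sum<-truncate 6 m _ 6≤m (λ _ → refl))

  ω₂≡sent-received : ω₂ R ≡ ℤ.+ totalSent N w ℤ.- ℤ.+ totalReceived N w
  ω₂≡sent-received = cong₂ (λ s r → ℤ.+ s ℤ.- ℤ.+ r) 4*count≡totalSent 2*|A|+|B|≡totalReceived

  dominated⁺ : ∀ k x y → (cell R x y ≡ false → k ≤ localNbrs R x y) →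
               T (dominated k x (w (prev N y)) (w y) (w (next N y)))
  dominated⁺ k x y h rewrite sym (cell≡bit x y) | sym (localNbrs≡columnNbrs x y) with cell R x y
  ... | true  = _
  ... | false = ≤⇒≤ᵇ (h refl)

  dominated⁻ : ∀ k x y → T (dominated k x (w (prev N y)) (w y) (w (next N y))) →
               cell R x y ≡ false → k ≤ localNbrs R x y
  dominated⁻ k x y t rewrite sym (cell≡bit x y) | sym (localNbrs≡columnNbrs x y) with cell R x y
  ... | false = λ _ → ≤ᵇ⇒≤ k _ t
  ... | true = λ ()

  Border2DomV1⇒FeasibleWord : Border2DomV1 R → FeasibleWord N w
  Border2DomV1⇒FeasibleWord (_ , dom₂ , dom₁) y y<N = feasible-intro (w (prev N y)) (w y) (w (next N y))
    (λ x x<4 → dominated⁺ 2 x y (toLocal (λ i j i≡x → dom₂ i j (subst (_< 4) (sym i≡x) x<4))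
                                        (<-trans x<4 4<m)))
    (dominated⁺ 1 4 y (toLocal (λ i j → dom₁ i j) 4<m))
    where
    4<m : 4 < m
    4<m = ≤-trans (n≤1+n 5) 6≤m
    toLocal : ∀ {k x} → (∀ i j → toℕ i ≡ x → R i j ≡ false → k ≤ nbrsIn R i j) → x < m →
            cell R x y ≡ false → k ≤ localNbrs R x y
    toLocal {k} {x} h x<m r = subst₂ (λ x′ y′ → k ≤ localNbrs R x′ y′) (toℕ-fromℕ< x<m) (toℕ-fromℕ< y<N)
      (subst (k ≤_) (nbrsIn≡localNbrs R 3≤N _ _)
        (h _ _ (toℕ-fromℕ< x<m) (trans (sym (cell-fromℕ< R x<m y<N)) r)))

  FeasibleWord⇒Border2DomV1 : FeasibleWord N w → Border2DomV1 R
  FeasibleWord⇒Border2DomV1 feasibleW = inV₁ , dom₂ , dom₁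
    where
    fromLocal : ∀ {k} i j → (cell R (toℕ i) (toℕ j) ≡ false → k ≤ localNbrs R (toℕ i) (toℕ j)) →
          R i j ≡ false → k ≤ nbrsIn R i j
    fromLocal {k} i j h r = subst (k ≤_) (sym (nbrsIn≡localNbrs R 3≤N i j)) (h (trans (cell-toℕ R i j) r))
    dominated₂ : ∀ x y → x < 4 → y < N → T (dominated 2 x (w (prev N y)) (w y) (w (next N y)))
    dominated₂ x y x<4 y<N = feasible⇒dominated₂ (w (prev N y)) (w y) (w (next N y)) (feasibleW y y<N) x x<4
    dominated₁ : ∀ y → y < N → T (dominated 1 4 (w (prev N y)) (w y) (w (next N y)))
    dominated₁ y y<N = feasible⇒dominated₁ (w (prev N y)) (w y) (w (next N y)) (feasibleW y y<N)
    dom₂ : ∀ i j → toℕ i < 4 → R i j ≡ false → 2 ≤ nbrsIn R i j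
    dom₂ i j i<4 = fromLocal i j (dominated⁻ 2 (toℕ i) (toℕ j) (dominated₂ (toℕ i) (toℕ j) i<4 (toℕ<n j)))
    dom₁ : ∀ i j → toℕ i ≡ 4 → R i j ≡ false → 1 ≤ nbrsIn R i j
    dom₁ i j i≡4 = fromLocal i j (subst (λ x → cell R x (toℕ j) ≡ false → 1 ≤ localNbrs R x (toℕ j)) (sym i≡4)
      (dominated⁻ 1 4 (toℕ j) (dominated₁ (toℕ j) (toℕ<n j))))

[+a+b]-[+b]≡+a : ∀ a b → ℤ.+ (a + b) ℤ.- ℤ.+ b ≡ ℤ.+ a
[+a+b]-[+b]≡+a a b = trans ([+m]-[+n]≡m⊖n (a + b) b) (trans (⊖-≥ (m≤n+m b a)) (cong ℤ.+_ (m+n∸n≡m a b)))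

module Realisation {m n} (3≤N : 3 ≤ suc n) (6≤m : 6 ≤ m) (w : ℕ → Column) where
  private
    N : ℕ
    N = suc n

  wordSet : VSet m N
  wordSet i j = bit (w (toℕ j)) (toℕ i)

  private
    inV₁ : ∀ i j → wordSet i j ≡ true → toℕ i < 5
    inV₁ i j = bit≡true⇒<5 (w (toℕ j)) (toℕ i)

    column-wordSet : ∀ y → y < N → column wordSet y ≡ w y
    column-wordSet y y<N = column≡ wordSet y (w y) λ x x<5 → let x<m = <-≤-trans x<5 (≤-trans (n≤1+n 5) 6≤m) in
      trans (cell-fromℕ< wordSet x<m y<N) (cong₂ (λ y′ x′ → bit (w y′) x′) (toℕ-fromℕ< y<N) (toℕ-fromℕ< x<m))

  open Columns wordSet 3≤N 6≤m inV₁

  realise : FeasibleWord N w →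
            Border2DomV1 wordSet × ω₂ wordSet ≡ ℤ.+ totalSent N w ℤ.- ℤ.+ totalReceived N w
  realise feasibleW =
    FeasibleWord⇒Border2DomV1 (FeasibleWord-cong N (λ y y<N → sym (column-wordSet y y<N)) feasibleW) ,
    trans ω₂≡sent-received
          (cong₂ (λ s r → ℤ.+ s ℤ.- ℤ.+ r) (totalSent-cong N column-wordSet) (totalReceived-cong N column-wordSet))

realisation : ∀ m N → 6 ≤ m → 3 ≤ N → (w : ℕ → Column) → FeasibleWord N w →
              ∀ v → totalSent N w ≡ v + totalReceived N w → ∃ λ (R : VSet m N) → Border2DomV1 R × ω₂ R ≡ ℤ.+ v
realisation m (suc n) 6≤m 3≤N w feasibleW v balance =
  wordSet , proj₁ realised , trans (proj₂ realised)
    (trans (cong (λ s → ℤ.+ s ℤ.- ℤ.+ totalReceived (suc n) w) balance) ([+a+b]-[+b]≡+a v (totalReceived (suc n) w)))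
  where
  open Realisation 3≤N 6≤m w
  realised : Border2DomV1 wordSet × ω₂ wordSet ≡ ℤ.+ totalSent (suc n) w ℤ.- ℤ.+ totalReceived (suc n) w
  realised = realise feasibleW

-- The discharging argument

≤-minus : ∀ a r s → a + r ≤ s → ℤ.+ a ℤ.≤ ℤ.+ s ℤ.- ℤ.+ r
≤-minus a r s a+r≤s = subst (ℤ.+ a ℤ.≤_) (sym (trans ([+m]-[+n]≡m⊖n s r) (⊖-≥ (≤-trans (m≤n+m r a) a+r≤s))))
                            (ℤ.+≤+ (m+n≤o⇒m≤o∸n a a+r≤s))

module _ (N r s e : ℕ) (discharged : 16 * N + 8 * r + e ≤ 8 * s) where
  private
    8*[2N+r]+e≤8*s : 8 * (2 * N + r) + e ≤ 8 * s
    8*[2N+r]+e≤8*s = subst (λ t → t + e ≤ 8 * s)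
      (solve 2 (λ N r → con 16 :* N :+ con 8 :* r := con 8 :* (con 2 :* N :+ r)) refl N r) discharged

  discharged⇒2N+r≤s : 2 * N + r ≤ s
  discharged⇒2N+r≤s = *-cancelˡ-≤ 8 (≤-trans (m≤m+n _ e) 8*[2N+r]+e≤8*s)

  discharged⇒2N+1+r≤s : 1 ≤ e → 2 * N + 1 + r ≤ s
  discharged⇒2N+1+r≤s 1≤e = subst (_≤ s) (sym (trans (+-assoc (2 * N) 1 r) (+-suc (2 * N) r)))
                                  (*-cancelˡ-< 8 _ _ (<-≤-trans (m<m+n _ 1≤e) 8*[2N+r]+e≤8*s))

  ω₂-value-≤ : (e ≡ 0 → T ((N ≡ᵇ 16) ∨ (N ≡ᵇ 19)) → ⊥) → ω₂-value N ℤ.≤ ℤ.+ s ℤ.- ℤ.+ r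
  ω₂-value-≤ exceptional with (N ≡ᵇ 16) ∨ (N ≡ᵇ 19)
  ... | false = ≤-minus (2 * N) r s discharged⇒2N+r≤s
  ... | true  = ≤-minus (2 * N + 1) r s (discharged⇒2N+1+r≤s (n≢0⇒n>0 λ e≡0 → exceptional e≡0 _))

-- Row i of cₖ is occupied iff bit i of k is 1.
pattern c₀ = col false false false false false
pattern c₁ = col true false false false false
pattern c₂ = col false true false false false
pattern c₃ = col true true false false false
pattern c₄ = col false false true false false
pattern c₅ = col true false true false false
pattern c₆ = col false true true false false
pattern c₇ = col true true true false false
pattern c₈ = col false false false true false
pattern c₉ = col true false false true false
pattern c₁₀ = col false true false true false
pattern c₁₁ = col true true false true false
pattern c₁₂ = col false false true true false
pattern c₁₃ = col true false true true false
pattern c₁₄ = col false true true true false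
pattern c₁₅ = col true true true true false
pattern c₁₆ = col false false false false true
pattern c₁₇ = col true false false false true
pattern c₁₈ = col false true false false true
pattern c₁₉ = col true true false false true
pattern c₂₀ = col false false true false true
pattern c₂₁ = col true false true false true
pattern c₂₂ = col false true true false true
pattern c₂₃ = col true true true false true
pattern c₂₄ = col false false false true true
pattern c₂₅ = col true false false true true
pattern c₂₆ = col false true false true true
pattern c₂₇ = col true true false true true
pattern c₂₈ = col false false true true true
pattern c₂₉ = col true false true true true
pattern c₃₀ = col false true true true true
pattern c₃₁ = col true true true true true

_≟ᶜ_ : DecidableEquality Column
col a₀ a₁ a₂ a₃ a₄ ≟ᶜ col b₀ b₁ b₂ b₃ b₄
  with a₀ ≟ᵇ b₀ | a₁ ≟ᵇ b₁ | a₂ ≟ᵇ b₂ | a₃ ≟ᵇ b₃ | a₄ ≟ᵇ b₄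
... | yes refl | yes refl | yes refl | yes refl | yes refl = yes refl
... | no ¬p | _ | _ | _ | _ = no (λ e → ¬p (cong Column.row₀ e))
... | _ | no ¬p | _ | _ | _ = no (λ e → ¬p (cong Column.row₁ e))
... | _ | _ | no ¬p | _ | _ = no (λ e → ¬p (cong Column.row₂ e))
... | _ | _ | _ | no ¬p | _ = no (λ e → ¬p (cong Column.row₃ e))
... | _ | _ | _ | _ | no ¬p = no (λ e → ¬p (cong Column.row₄ e))

open import Data.List.Membership.DecPropositional _≟ᶜ_ using () renaming (_∈?_ to _∈ᶜ?_)

bools : List Bool
bools = false ∷ true ∷ []

∈-bools : ∀ b → b ∈ bools
∈-bools false = here refl
∈-bools true  = there (here refl)

_⊛_ : ∀ {A B : Set} → List (A → B) → List A → List B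
_⊛_ = cartesianProductWith (λ f x → f x)

infixl 5 _⊛_

allColumns : List Column
allColumns = map col bools ⊛ bools ⊛ bools ⊛ bools ⊛ bools

∈-⊛ : ∀ {A B : Set} {fs : List (A → B)} {xs f x} → f ∈ fs → x ∈ xs → f x ∈ fs ⊛ xs
∈-⊛ = ∈-cartesianProductWith⁺ (λ f x → f x)

∈-allColumns : ∀ c → c ∈ allColumns
∈-allColumns (col b₀ b₁ b₂ b₃ b₄) =
  ∈-⊛ (∈-⊛ (∈-⊛ (∈-⊛ (∈-map⁺ col (∈-bools b₀)) (∈-bools b₁)) (∈-bools b₂)) (∈-bools b₃)) (∈-bools b₄)

data Trie : Set where
  leaf : ℕ → Trie
  node : Trie → Trie → Trie

branch : Bool → Trie → Trie
branch _     (leaf n)   = leaf n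
branch false (node l r) = l
branch true  (node l r) = r

value : Trie → ℕ
value (leaf n)   = n
value (node _ _) = 0

-- potentialRow a is a binary trie over the rows of b, row₀ at the root; a leaf above depth 5
-- is constant on its subtree.
potentialRow : Column → Trie
potentialRow c₀ = node (leaf 97) (node (leaf 97) (node (leaf 97) (node (leaf 97) (node (leaf 8) (leaf 0)))))
potentialRow c₁ = node (node (node (leaf 97) (node (leaf 97) (node (leaf 56) (leaf 41)))) (node (leaf 97) (node (leaf 97) (node (leaf 50) (leaf 13))))) (node (node (leaf 97) (node (leaf 97) (node (leaf 56) (leaf 41)))) (node (leaf 97) (node (leaf 97) (node (leaf 50) (leaf 13)))))
potentialRow c₂ = node (node (node (node (leaf 97) (node (leaf 56) (leaf 44))) (node (leaf 97) (node (leaf 36) (leaf 13)))) (node (node (leaf 97) (node (leaf 56) (leaf 44))) (node (leaf 97) (node (leaf 36) (leaf 13))))) (node (node (node (leaf 97) (node (leaf 56) (leaf 41))) (node (leaf 97) (node (leaf 36) (leaf 13)))) (node (node (leaf 97) (node (leaf 56) (leaf 41))) (node (leaf 97) (node (leaf 36) (leaf 13)))))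
potentialRow c₃ = node (node (node (node (leaf 97) (node (leaf 84) (leaf 58))) (node (leaf 97) (node (leaf 60) (leaf 52)))) (node (node (leaf 97) (node (leaf 84) (leaf 58))) (node (leaf 97) (node (leaf 60) (leaf 52))))) (node (node (node (leaf 97) (node (leaf 84) (leaf 58))) (node (leaf 97) (node (leaf 60) (leaf 52)))) (node (node (leaf 97) (node (leaf 84) (leaf 58))) (node (leaf 97) (node (leaf 60) (leaf 52)))))
potentialRow c₄ = node (leaf 97) (node (node (node (node (leaf 56) (leaf 44)) (node (leaf 47) (leaf 38))) (node (node (leaf 56) (leaf 44)) (node (leaf 46) (leaf 38)))) (node (node (node (leaf 36) (leaf 15)) (node (leaf 32) (leaf 14))) (node (node (leaf 36) (leaf 14)) (node (leaf 32) (leaf 14)))))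
potentialRow c₅ = node (node (node (node (node (leaf 84) (leaf 62)) (node (leaf 46) (leaf 38))) (node (node (leaf 84) (leaf 62)) (node (leaf 47) (leaf 38)))) (node (node (node (leaf 84) (leaf 63)) (node (leaf 47) (leaf 38))) (node (node (leaf 84) (leaf 62)) (node (leaf 46) (leaf 38))))) (node (node (node (node (leaf 84) (leaf 62)) (node (leaf 47) (leaf 38))) (node (node (leaf 84) (leaf 62)) (node (leaf 46) (leaf 38)))) (node (node (node (leaf 84) (leaf 62)) (node (leaf 46) (leaf 38))) (node (node (leaf 84) (leaf 62)) (node (leaf 46) (leaf 38)))))
potentialRow c₆ = node (node (node (node (node (leaf 84) (leaf 62)) (node (leaf 52) (leaf 44))) (node (node (leaf 84) (leaf 62)) (node (leaf 52) (leaf 44)))) (node (node (node (leaf 84) (leaf 63)) (node (leaf 52) (leaf 44))) (node (node (leaf 84) (leaf 62)) (node (leaf 52) (leaf 44))))) (node (node (node (node (leaf 84) (leaf 61)) (node (leaf 47) (leaf 38))) (node (node (leaf 84) (leaf 61)) (node (leaf 46) (leaf 38)))) (node (node (node (leaf 84) (leaf 61)) (node (leaf 46) (leaf 38))) (node (node (leaf 84) (leaf 61)) (node (leaf 46) (leaf 38)))))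
potentialRow c₇ = node (node (node (node (node (leaf 97) (leaf 62)) (node (leaf 95) (leaf 62))) (node (node (leaf 97) (leaf 63)) (node (leaf 94) (leaf 62)))) (node (node (node (leaf 97) (leaf 63)) (node (leaf 94) (leaf 62))) (node (node (leaf 97) (leaf 62)) (node (leaf 94) (leaf 62))))) (node (node (node (node (leaf 97) (leaf 62)) (node (leaf 94) (leaf 62))) (node (node (leaf 97) (leaf 62)) (node (leaf 94) (leaf 62)))) (node (node (node (leaf 97) (leaf 62)) (node (leaf 94) (leaf 62))) (node (node (leaf 97) (leaf 62)) (node (leaf 94) (leaf 62)))))
potentialRow c₈ = node (leaf 97) (node (leaf 97) (node (node (node (leaf 46) (leaf 47)) (leaf 46)) (node (leaf 7) (leaf 6))))
potentialRow c₉ = node (node (node (node (node (leaf 54) (leaf 46)) (node (leaf 54) (leaf 46))) (node (node (leaf 55) (leaf 47)) (node (leaf 54) (leaf 46)))) (node (node (node (leaf 54) (leaf 47)) (node (leaf 54) (leaf 46))) (node (node (leaf 55) (leaf 46)) (node (leaf 54) (leaf 46))))) (node (node (node (node (leaf 54) (leaf 46)) (node (leaf 54) (leaf 46))) (node (node (leaf 55) (leaf 46)) (node (leaf 54) (leaf 46)))) (node (node (node (leaf 54) (leaf 47)) (node (leaf 54) (leaf 46))) (node (node (leaf 54) (leaf 46)) (node (leaf 54) (leaf 46)))))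
potentialRow c₁₀ = node (node (node (node (node (leaf 54) (leaf 46)) (node (leaf 54) (leaf 46))) (node (node (leaf 54) (leaf 46)) (node (leaf 54) (leaf 46)))) (node (node (node (leaf 54) (leaf 47)) (node (leaf 54) (leaf 46))) (node (node (leaf 54) (leaf 46)) (node (leaf 54) (leaf 46))))) (node (node (node (node (leaf 54) (leaf 46)) (node (leaf 54) (leaf 46))) (node (node (leaf 55) (leaf 46)) (node (leaf 54) (leaf 46)))) (node (node (node (leaf 54) (leaf 47)) (node (leaf 54) (leaf 46))) (node (node (leaf 54) (leaf 46)) (node (leaf 54) (leaf 46)))))
potentialRow c₁₁ = node (node (node (node (node (leaf 85) (leaf 79)) (node (leaf 85) (leaf 79))) (node (node (leaf 85) (leaf 79)) (node (leaf 85) (leaf 79)))) (node (node (node (leaf 85) (leaf 79)) (node (leaf 85) (leaf 79))) (node (node (leaf 85) (leaf 79)) (node (leaf 85) (leaf 79))))) (node (node (node (node (leaf 85) (leaf 79)) (node (leaf 85) (leaf 79))) (node (node (leaf 85) (leaf 79)) (node (leaf 85) (leaf 79)))) (node (node (node (leaf 85) (leaf 79)) (node (leaf 85) (leaf 79))) (node (node (leaf 85) (leaf 79)) (node (leaf 85) (leaf 79)))))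
potentialRow c₁₂ = node (leaf 97) (node (node (leaf 54) (node (node (leaf 55) (leaf 54)) (leaf 54))) (node (node (node (leaf 51) (leaf 47)) (node (leaf 51) (leaf 46))) (node (node (leaf 51) (leaf 46)) (node (leaf 51) (leaf 46)))))
potentialRow c₁₃ = node (node (node (node (node (leaf 85) (leaf 83)) (node (leaf 85) (leaf 83))) (node (node (leaf 85) (leaf 83)) (node (leaf 85) (leaf 83)))) (node (node (node (leaf 85) (leaf 83)) (node (leaf 85) (leaf 83))) (node (node (leaf 85) (leaf 83)) (node (leaf 85) (leaf 83))))) (node (node (node (node (leaf 85) (leaf 83)) (node (leaf 85) (leaf 83))) (node (node (leaf 85) (leaf 83)) (node (leaf 85) (leaf 83)))) (node (node (node (leaf 85) (leaf 83)) (node (leaf 85) (leaf 83))) (node (node (leaf 85) (leaf 83)) (node (leaf 85) (leaf 83)))))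
potentialRow c₁₄ = leaf 82
potentialRow c₁₆ = node (leaf 97) (node (leaf 97) (node (leaf 97) (node (leaf 40) (leaf 5))))
potentialRow c₁₇ = node (node (node (leaf 97) (node (leaf 73) (leaf 52))) (node (leaf 97) (node (leaf 45) (leaf 35)))) (node (node (leaf 97) (node (leaf 73) (leaf 52))) (node (leaf 97) (node (leaf 45) (leaf 35))))
potentialRow c₁₈ = node (node (node (node (leaf 74) (leaf 54)) (leaf 38)) (node (node (leaf 74) (node (leaf 55) (leaf 54))) (node (node (leaf 39) (leaf 38)) (leaf 38)))) (node (node (node (leaf 73) (node (leaf 55) (leaf 54))) (node (node (leaf 39) (leaf 38)) (leaf 38))) (node (node (leaf 73) (leaf 54)) (node (node (leaf 39) (leaf 38)) (leaf 38))))
potentialRow c₁₉ = node (node (node (node (leaf 86) (node (leaf 55) (leaf 54))) (node (node (leaf 87) (leaf 86)) (node (leaf 55) (leaf 54)))) (node (node (leaf 86) (node (leaf 55) (leaf 54))) (node (leaf 86) (leaf 54)))) (node (node (node (leaf 86) (node (leaf 55) (leaf 54))) (node (leaf 86) (leaf 54))) (node (node (leaf 86) (leaf 54)) (node (leaf 86) (leaf 54))))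
potentialRow c₂₀ = node (leaf 97) (node (node (node (leaf 54) (node (leaf 55) (leaf 54))) (leaf 54)) (node (leaf 38) (node (node (leaf 39) (leaf 38)) (leaf 38))))
potentialRow c₂₁ = leaf 77
potentialRow c₂₂ = node (leaf 84) (leaf 77)
potentialRow c₂₃ = node (node (node (node (leaf 94) (node (leaf 95) (leaf 94))) (leaf 94)) (leaf 94)) (leaf 94)
potentialRow c₂₄ = node (leaf 97) (node (leaf 97) (node (leaf 53) (leaf 45)))
potentialRow c₂₅ = leaf 77
potentialRow c₂₆ = leaf 77
potentialRow c₂₈ = node (leaf 97) (node (leaf 91) (leaf 77))
potentialRow _ = leaf 97

criticalSuccessors : Column → Column → List Column
criticalSuccessors c₄ c₉ = c₆ ∷ c₁₈ ∷ c₁₉ ∷ []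
criticalSuccessors c₄ c₁₉ = c₈ ∷ c₉ ∷ c₁₀ ∷ c₁₂ ∷ []
criticalSuccessors c₅ c₉ = c₆ ∷ c₁₈ ∷ c₁₉ ∷ []
criticalSuccessors c₅ c₁₀ = c₅ ∷ c₁₈ ∷ c₁₉ ∷ []
criticalSuccessors c₅ c₁₂ = c₁₉ ∷ []
criticalSuccessors c₅ c₁₈ = c₉ ∷ c₁₀ ∷ []
criticalSuccessors c₆ c₉ = c₄ ∷ c₅ ∷ c₆ ∷ c₁₈ ∷ c₁₉ ∷ c₂₀ ∷ []
criticalSuccessors c₆ c₁₈ = c₉ ∷ []
criticalSuccessors c₇ c₈ = c₁₉ ∷ []
criticalSuccessors c₇ c₁₈ = c₉ ∷ c₁₀ ∷ []
criticalSuccessors c₇ c₂₀ = c₉ ∷ []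
criticalSuccessors c₈ c₇ = c₁₈ ∷ c₂₀ ∷ []
criticalSuccessors c₈ c₁₉ = c₄ ∷ []
criticalSuccessors c₈ c₂₃ = c₈ ∷ []
criticalSuccessors c₉ c₄ = c₁₉ ∷ []
criticalSuccessors c₉ c₅ = c₁₈ ∷ []
criticalSuccessors c₉ c₆ = c₁₈ ∷ []
criticalSuccessors c₉ c₁₈ = c₅ ∷ c₆ ∷ c₇ ∷ []
criticalSuccessors c₉ c₁₉ = c₄ ∷ []
criticalSuccessors c₉ c₂₀ = c₇ ∷ []
criticalSuccessors c₁₀ c₅ = c₁₈ ∷ []
criticalSuccessors c₁₀ c₁₈ = c₅ ∷ c₇ ∷ []
criticalSuccessors c₁₀ c₁₉ = c₄ ∷ []
criticalSuccessors c₁₂ c₅ = c₁₈ ∷ []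
criticalSuccessors c₁₂ c₁₉ = c₄ ∷ []
criticalSuccessors c₁₈ c₅ = c₉ ∷ c₁₀ ∷ c₁₂ ∷ []
criticalSuccessors c₁₈ c₆ = c₉ ∷ []
criticalSuccessors c₁₈ c₇ = c₈ ∷ []
criticalSuccessors c₁₈ c₉ = c₄ ∷ c₅ ∷ c₆ ∷ []
criticalSuccessors c₁₈ c₁₀ = c₅ ∷ []
criticalSuccessors c₁₉ c₄ = c₉ ∷ []
criticalSuccessors c₁₉ c₈ = c₇ ∷ c₂₃ ∷ []
criticalSuccessors c₁₉ c₉ = c₄ ∷ c₅ ∷ c₆ ∷ []
criticalSuccessors c₁₉ c₁₀ = c₅ ∷ []
criticalSuccessors c₁₉ c₁₂ = c₅ ∷ []
criticalSuccessors c₂₀ c₇ = c₈ ∷ []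
criticalSuccessors c₂₀ c₉ = c₆ ∷ []
criticalSuccessors c₂₃ c₈ = c₁₉ ∷ []
criticalSuccessors _ _ = []

potential : Column → Column → ℕ
potential a (col b₀ b₁ b₂ b₃ b₄) =
  value (branch b₄ (branch b₃ (branch b₂ (branch b₁ (branch b₀ (potentialRow a))))))

critical : Column → Column → Column → Bool
critical a b c = isYes (c ∈ᶜ? criticalSuccessors a b)

allTriples : (Column → Column → Column → Bool) → Bool
allTriples P = all (λ a → all (λ b → all (λ c → P a b c) allColumns) allColumns) allColumns

allTriples⁻ : ∀ P → allTriples P ≡ true → ∀ a b c → T (P a b c)
allTriples⁻ P e a b c =
  T-all-∈ (P a b) allColumns
    (T-all-∈ (λ b → all (P a b) allColumns) allColumns
      (T-all-∈ (λ a → all (λ b → all (P a b) allColumns) allColumns) allColumns (Equivalence.from T-≡ e) (∈-allColumns a))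
      (∈-allColumns b))
    (∈-allColumns c)

discharging-check : allTriples (λ a b c → not (feasible a b c) ∨
  (16 + 8 * received a b c + ⟦ not (critical a b c) ⟧ + potential b c ≤ᵇ 8 * sent b + potential a b)) ≡ true
discharging-check = refl

discharging : ∀ a b c → T (feasible a b c) →
  16 + 8 * received a b c + ⟦ not (critical a b c) ⟧ + potential b c ≤ 8 * sent b + potential a b
discharging a b c f = ≤ᵇ⇒≤ (16 + 8 * received a b c + ⟦ not (critical a b c) ⟧ + potential b c) (8 * sent b + potential a b)
  (implies (feasible a b c) _ (allTriples⁻ (λ a b c → not (feasible a b c) ∨
    (16 + 8 * received a b c + ⟦ not (critical a b c) ⟧ + potential b c ≤ᵇ 8 * sent b + potential a b))
    discharging-check a b c) f)
  where
  implies : ∀ p q → T (not p ∨ q) → T p → T q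
  implies true _ t _ = t

module LowerBound {m n} (R : VSet m (suc n)) (3≤N : 3 ≤ suc n) (6≤m : 6 ≤ m) (dom : Border2DomV1 R) where
  private
    N : ℕ
    N = suc n

  w : ℕ → Column
  w = column R
  open Columns R 3≤N 6≤m (proj₁ dom)

  noncritical : ℕ → ℕ
  noncritical y = ⟦ not (critical (w (prev N y)) (w y) (w (next N y))) ⟧

  discharged : 16 * N + 8 * totalReceived N w + sum< N noncritical ≤ 8 * totalSent N w
  discharged = subst₂ _≤_ totalIn totalOut (telescope-≤ N paidIn paidOut carried balance)
    where
    paidIn paidOut carried : ℕ → ℕ
    paidIn y  = 16 + 8 * received (w (prev N y)) (w y) (w (next N y)) + noncritical y
    paidOut y = 8 * sent (w y)
    carried y = potential (w y) (w (next N y))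
    balance : ∀ y → y < N → paidIn y + carried y ≤ paidOut y + carried (prev N y)
    balance y y<N = subst (λ z → paidIn y + carried y ≤ paidOut y + potential (w (prev N y)) (w z))
                       (sym (next-prev N y y<N))
                       (discharging (w (prev N y)) (w y) (w (next N y)) (Border2DomV1⇒FeasibleWord dom y y<N))
    totalIn : sum< N paidIn ≡ 16 * N + 8 * totalReceived N w + sum< N noncritical
    totalIn = begin
      sum< N paidIn
        ≡⟨ sum<-distrib-+ N (λ y → 16 + 8 * received (w (prev N y)) (w y) (w (next N y))) noncritical ⟩
      ∑[ y < N ] (16 + 8 * received (w (prev N y)) (w y) (w (next N y))) + sum< N noncritical
        ≡⟨ cong (_+ sum< N noncritical) (sum<-distrib-+ N (λ _ → 16) (λ y → 8 * received (w (prev N y)) (w y) (w (next N y)))) ⟩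
      ∑[ y < N ] 16 + ∑[ y < N ] (8 * received (w (prev N y)) (w y) (w (next N y))) + sum< N noncritical
        ≡⟨ cong₂ (λ s t → s + t + sum< N noncritical) (sum<-const N 16)
                 (*-distribˡ-sum< N 8 (λ y → received (w (prev N y)) (w y) (w (next N y)))) ⟩
      16 * N + 8 * totalReceived N w + sum< N noncritical ∎
      where open ≡-Reasoning
    totalOut : sum< N paidOut ≡ 8 * totalSent N w
    totalOut = *-distribˡ-sum< N 8 (sent ∘ w)

  ω₂-value≤ω₂ : (sum< N noncritical ≡ 0 → T ((N ≡ᵇ 16) ∨ (N ≡ᵇ 19)) → ⊥) → ω₂-value N ℤ.≤ ω₂ R
  ω₂-value≤ω₂ exceptional = subst (ω₂-value N ℤ.≤_) (sym ω₂≡sent-received)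
    (ω₂-value-≤ N (totalReceived N w) (totalSent N w) (sum< N noncritical) discharged exceptional)

  everywhere-critical : sum< N noncritical ≡ 0 → ∀ y → y < N → T (critical (w (prev N y)) (w y) (w (next N y)))
  everywhere-critical none y y<N with critical (w (prev N y)) (w y) (w (next N y)) | sum<≡0⇒ N noncritical none y y<N
  ... | true | _ = _

-- Closed walks of critical triples

State : Set
State = Column × Column

_≟ˢ_ : DecidableEquality State
_≟ˢ_ = ≡-dec _≟ᶜ_ _≟ᶜ_

open import Data.List.Membership.DecPropositional _≟ˢ_ using () renaming (_∈?_ to _∈ˢ?_)

successors : State → List State
successors (a , b) = map (b ,_) (criticalSuccessors a b)

step : List State → List State
step L = deduplicate _≟ˢ_ (concatMap successors L)

reachable : ℕ → State → List State
reachable k s = fold (s ∷ []) step k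

noCriticalCycle : ℕ → Bool
noCriticalCycle N = all (λ s → isNo (s ∈ˢ? reachable N s)) (cartesianProduct allColumns allColumns)

noCriticalCycle-16 : noCriticalCycle 16 ≡ true
noCriticalCycle-16 = refl

noCriticalCycle-19 : noCriticalCycle 19 ≡ true
noCriticalCycle-19 = refl

exceptional⇒noCriticalCycle : ∀ N → T ((N ≡ᵇ 16) ∨ (N ≡ᵇ 19)) → noCriticalCycle N ≡ true
exceptional⇒noCriticalCycle N t = [
  (λ N≡16 → subst (λ k → noCriticalCycle k ≡ true) (sym (≡ᵇ⇒≡ N 16 N≡16)) noCriticalCycle-16) ,
  (λ N≡19 → subst (λ k → noCriticalCycle k ≡ true) (sym (≡ᵇ⇒≡ N 19 N≡19)) noCriticalCycle-19) ]′
  (Equivalence.to T-∨ t)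

successor-of-critical : ∀ a b c → T (critical a b c) → (b , c) ∈ successors (a , b)
successor-of-critical a b c t = ∈-map⁺ (b ,_) (toWitness t)

∈-step : ∀ {s t L} → s ∈ L → t ∈ successors s → t ∈ step L
∈-step s∈L t∈succ = ∈-deduplicate⁺ _≟ˢ_ (∈-concatMap⁺ successors (lose s∈L t∈succ))

no-critical-cycle : ∀ n (w : ℕ → Column) → noCriticalCycle (suc n) ≡ true →
  ¬ (∀ y → y < suc n → T (critical (w (prev (suc n) y)) (w y) (w (next (suc n) y))))
no-critical-cycle n w noCycle critical-everywhere = toWitnessFalse returnsNot closed
  where
  N : ℕ
  N = suc n
  state : ℕ → State
  state y = (w y , w (next N y))
  returnsNot : T (isNo (state 0 ∈ˢ? reachable N (state 0)))
  returnsNot = T-all-∈ (λ s → isNo (s ∈ˢ? reachable N s)) (cartesianProduct allColumns allColumns)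
                       (Equivalence.from T-≡ noCycle)
                       (∈-cartesianProduct⁺ (∈-allColumns (w 0)) (∈-allColumns (w (next N 0))))
  advance : ∀ {k} y → y < N → (w (prev N y) , w y) ∈ reachable k (state 0) → state y ∈ reachable (suc k) (state 0)
  advance y y<N reached =
    ∈-step reached (successor-of-critical (w (prev N y)) (w y) (w (next N y)) (critical-everywhere y y<N))
  walk : ∀ k → k < N → state k ∈ reachable k (state 0)
  walk zero    _    = here refl
  walk (suc k) sk<N = advance {k} (suc k) sk<N
    (subst (λ z → (w k , w z) ∈ reachable k (state 0)) (next-suc N k sk<N) (walk k (<-trans (n<1+n k) sk<N)))
  closed : state 0 ∈ reachable N (state 0)
  closed = advance {n} 0 z<s (subst (λ z → (w n , w z) ∈ reachable n (state 0)) (next-last n) (walk n (n<1+n n)))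

-- Constructions

nth : List Column → ℕ → Column
nth []      _       = c₀
nth (c ∷ _) zero    = c
nth (_ ∷ l) (suc k) = nth l k

triplesAll : (Column → Column → Column → Bool) → List Column → Bool
triplesAll P (a ∷ b ∷ c ∷ l) = P a b c ∧ triplesAll P (b ∷ c ∷ l)
triplesAll P _               = true

triplesAll⁻ : ∀ P l → T (triplesAll P l) → ∀ k → suc (suc k) < length l →
              T (P (nth l k) (nth l (suc k)) (nth l (suc (suc k))))
triplesAll⁻ P (a ∷ b ∷ c ∷ l) t zero    _        = proj₁ (T-∧-split (P a b c) t)
triplesAll⁻ P (a ∷ b ∷ c ∷ l) t (suc k) (s≤s lt) = triplesAll⁻ P (b ∷ c ∷ l) (proj₂ (T-∧-split (P a b c) t)) k lt
triplesAll⁻ P (a ∷ b ∷ []) t k (s≤s (s≤s ()))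
triplesAll⁻ P (a ∷ [])     t k (s≤s ())
triplesAll⁻ P []           t k ()

-- A cyclic word of length N is stored as a list of length N + 2 whose last two entries repeat
-- its first two.
cyclic-triples : ∀ P N l → length l ≡ 2 + N → nth l N ≡ nth l 0 → nth l (suc N) ≡ nth l 1 →
                 T (triplesAll P l) → 2 ≤ N → ∀ y → y < N → T (P (nth l (prev N y)) (nth l y) (nth l (next N y)))
cyclic-triples P (suc n) l len wrap₀ wrap₁ t 2≤N zero _ with next-cases (suc n) 0 z<s
... | inj₂ (1≡N , _) = ⊥-elim (<-irrefl 1≡N 2≤N)
... | inj₁ (_ , eq) rewrite eq =
  subst₂ (λ b c → T (P (nth l n) b c)) wrap₀ wrap₁ (triplesAll⁻ P l t n (≤-reflexive (sym len)))
cyclic-triples P N l len wrap₀ wrap₁ t 2≤N (suc y) sy<N with next-cases N (suc y) sy<N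
... | inj₁ (_ , eq)     rewrite eq = triplesAll⁻ P l t y inside
  where
  inside : suc (suc y) < length l
  inside = subst (suc (suc y) <_) (sym len) (m<n⇒m<1+n (s≤s sy<N))
... | inj₂ (ssy≡N , eq) rewrite eq =
  subst (λ c → T (P (nth l y) (nth l (suc y)) c)) (trans (cong (nth l) ssy≡N) wrap₀) (triplesAll⁻ P l t y inside)
  where
  inside : suc (suc y) < length l
  inside = subst (suc (suc y) <_) (sym len) (m<n⇒m<1+n (s≤s sy<N))

tightPotential : Column → Column → ℕ
tightPotential c₄  c₉  = 6
tightPotential c₄  c₁₉ = 2
tightPotential c₆  c₉  = 6
tightPotential c₈  c₁₉ = 6
tightPotential c₈  c₂₃ = 1
tightPotential c₉  c₄  = 7
tightPotential c₉  c₁₈ = 6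
tightPotential c₁₈ c₆  = 5
tightPotential c₁₉ c₄  = 11
tightPotential c₁₉ c₈  = 7
tightPotential c₂₃ c₈  = 12
tightPotential _   _   = 0

tight : Column → Column → Column → Bool
tight a b c = feasible a b c ∧ (2 + received a b c + tightPotential b c ≡ᵇ sent b + tightPotential a b)

block₃ block₁₁ : List Column
block₃  = c₁₈ ∷ c₆ ∷ c₉ ∷ []
block₁₁ = c₄ ∷ c₁₉ ∷ c₈ ∷ c₂₃ ∷ c₈ ∷ c₁₉ ∷ c₄ ∷ c₉ ∷ c₁₈ ∷ c₆ ∷ c₉ ∷ []

periodicWord : ℕ → ℕ → List Column
periodicWord q r = c₆ ∷ c₉ ∷ fold (fold [] (block₁₁ ++_) r) (block₃ ++_) q

periodicWord-tight : ∀ q r → T (triplesAll tight (periodicWord q r))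
periodicWord-tight (suc q) r       = periodicWord-tight q r
periodicWord-tight zero    (suc r) = periodicWord-tight zero r
periodicWord-tight zero    zero    = _

length-periodicWord : ∀ q r → length (periodicWord q r) ≡ 2 + (3 * q + 11 * r)
length-periodicWord (suc q) r =
  trans (cong (3 +_) (length-periodicWord q r))
        (solve 2 (λ q r → con 3 :+ (con 2 :+ (con 3 :* q :+ con 11 :* r))
                      := con 2 :+ (con 3 :* (con 1 :+ q) :+ con 11 :* r)) refl q r)
length-periodicWord zero (suc r) =
  trans (cong (11 +_) (length-periodicWord zero r))
        (solve 1 (λ r → con 11 :+ (con 2 :+ con 11 :* r) := con 2 :+ con 11 :* (con 1 :+ r)) refl r)
length-periodicWord zero zero = refl

nth-periodicWord : ∀ q r k → nth (periodicWord q r) (3 * q + 11 * r + k) ≡ nth (c₆ ∷ c₉ ∷ []) k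
nth-periodicWord (suc q) r k =
  trans (cong (nth (periodicWord (suc q) r))
          (solve 3 (λ q r k → con 3 :* (con 1 :+ q) :+ con 11 :* r :+ k
                           := con 3 :+ (con 3 :* q :+ con 11 :* r :+ k)) refl q r k))
        (nth-periodicWord q r k)
nth-periodicWord zero (suc r) k =
  trans (cong (nth (periodicWord zero (suc r)))
          (solve 2 (λ r k → con 11 :* (con 1 :+ r) :+ k := con 11 :+ (con 11 :* r :+ k)) refl r k))
        (nth-periodicWord zero r k)
nth-periodicWord zero zero k = refl

tight-word : ∀ N (w : ℕ → Column) → (∀ y → y < N → T (tight (w (prev N y)) (w y) (w (next N y)))) →
                 FeasibleWord N w × totalSent N w ≡ 2 * N + totalReceived N w
tight-word N w tightW = (λ y y<N → proj₁ (split y y<N)) , sym (begin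
  2 * N + totalReceived N w
    ≡⟨ cong (_+ totalReceived N w) (sum<-const N 2) ⟨
  ∑[ y < N ] 2 + totalReceived N w
    ≡⟨ sum<-distrib-+ N (λ _ → 2) (λ y → received (w (prev N y)) (w y) (w (next N y))) ⟨
  ∑[ y < N ] (2 + received (w (prev N y)) (w y) (w (next N y)))
    ≡⟨ telescope-≡ N _ (sent ∘ w) carried balance ⟩
  totalSent N w ∎)
  where
  open ≡-Reasoning
  split : ∀ y → y < N → T (feasible (w (prev N y)) (w y) (w (next N y)))
                        × T (2 + received (w (prev N y)) (w y) (w (next N y)) + tightPotential (w y) (w (next N y))
                             ≡ᵇ sent (w y) + tightPotential (w (prev N y)) (w y))
  split y y<N = T-∧-split (feasible (w (prev N y)) (w y) (w (next N y))) (tightW y y<N)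
  carried : ℕ → ℕ
  carried y = tightPotential (w y) (w (next N y))
  balance : ∀ y → y < N →
            2 + received (w (prev N y)) (w y) (w (next N y)) + carried y ≡ sent (w y) + carried (prev N y)
  balance y y<N = trans (≡ᵇ⇒≡ _ _ (proj₂ (split y y<N)))
                        (cong (λ z → sent (w y) + tightPotential (w (prev N y)) (w z)) (sym (next-prev N y y<N)))

periodic-realisation : ∀ m N q r → 6 ≤ m → 3 ≤ N → N ≡ 3 * q + 11 * r →
                       ∃ λ (R : VSet m N) → Border2DomV1 R × ω₂ R ≡ ℤ.+ (2 * N)
periodic-realisation m _ q r 6≤m 3≤N refl = realisation m N 6≤m 3≤N (nth l) (proj₁ balanced) (2 * N) (proj₂ balanced)
  where
  N : ℕ
  N = 3 * q + 11 * r
  l : List Column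
  l = periodicWord q r
  wrap₀ : nth l N ≡ nth l 0
  wrap₀ = trans (cong (nth l) (sym (+-identityʳ N))) (nth-periodicWord q r 0)
  wrap₁ : nth l (suc N) ≡ nth l 1
  wrap₁ = trans (cong (nth l) (+-comm 1 N)) (nth-periodicWord q r 1)
  balanced : FeasibleWord N (nth l) × totalSent N (nth l) ≡ 2 * N + totalReceived N (nth l)
  balanced = tight-word N (nth l)
    (cyclic-triples tight N l (length-periodicWord q r) wrap₀ wrap₁ (periodicWord-tight q r) (≤-trans (n≤1+n 2) 3≤N))

word₁₆ word₁₉ : List Column
word₁₆ = c₄ ∷ c₉ ∷ c₁₈ ∷ c₅ ∷ c₉ ∷ c₁₈ ∷ c₅ ∷ c₁₀ ∷ c₁₈ ∷ c₅ ∷ c₁₀ ∷ c₁₈ ∷ c₅ ∷ c₉ ∷ c₁₀ ∷ c₁₉ ∷ c₄ ∷ c₉ ∷ []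
word₁₉ = c₄ ∷ c₉ ∷ c₆ ∷ c₁₈ ∷ c₉ ∷ c₄ ∷ c₁₉ ∷ c₈ ∷ c₇ ∷ c₁₈ ∷ c₉ ∷ c₄ ∷ c₁₉ ∷ c₈ ∷ c₇ ∷ c₁₆ ∷ c₁₅ ∷ c₈ ∷ c₁₉ ∷ c₄ ∷ c₉ ∷ []

explicit-realisation : ∀ m N l → 6 ≤ m → 3 ≤ N → length l ≡ 2 + N → nth l N ≡ nth l 0 → nth l (suc N) ≡ nth l 1 →
  triplesAll feasible l ≡ true → ∀ v → totalSent N (nth l) ≡ v + totalReceived N (nth l) →
  ∃ λ (R : VSet m N) → Border2DomV1 R × ω₂ R ≡ ℤ.+ v
explicit-realisation m N l 6≤m 3≤N len wrap₀ wrap₁ feasibleL =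
  realisation m N 6≤m 3≤N (nth l)
    (cyclic-triples feasible N l len wrap₀ wrap₁ (Equivalence.from T-≡ feasibleL) (≤-trans (n≤1+n 2) 3≤N))

20+k≡3q+11r : ∀ k → ∃ λ q → ∃ λ r → 20 + k ≡ 3 * q + 11 * r
20+k≡3q+11r 0 = 3 , 1 , refl
20+k≡3q+11r 1 = 7 , 0 , refl
20+k≡3q+11r 2 = 0 , 2 , refl
20+k≡3q+11r (suc (suc (suc k))) with 20+k≡3q+11r k
... | q , r , eq = suc q , r , trans (cong (3 +_) eq)
  (solve 2 (λ q r → con 3 :+ (con 3 :* q :+ con 11 :* r) := con 3 :* (con 1 :+ q) :+ con 11 :* r) refl q r)

upper-bound : ∀ m k → 6 ≤ m → ∃ λ (R : VSet m (16 + k)) → Border2Dominating R × ω₂ R ≡ ω₂-value (16 + k)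
upper-bound m k 6≤m = within-V₁ (construction k)
  where
  within-V₁ : ∀ {N v} → ∃ (λ (R : VSet m N) → Border2DomV1 R × ω₂ R ≡ v) →
                        ∃ (λ (R : VSet m N) → Border2Dominating R × ω₂ R ≡ v)
  within-V₁ (R , dom , eq) = R , inj₁ dom , eq
  3≤ : ∀ k → 3 ≤ 16 + k
  3≤ k = ≤-trans (m≤m+n 3 13) (m≤m+n 16 k)
  construction : ∀ k → ∃ λ (R : VSet m (16 + k)) → Border2DomV1 R × ω₂ R ≡ ω₂-value (16 + k)
  construction 0 = explicit-realisation m 16 word₁₆ 6≤m (3≤ 0) refl refl refl refl 33 refl
  construction 1 = periodic-realisation m 17 2 1 6≤m (3≤ 1) refl
  construction 2 = periodic-realisation m 18 6 0 6≤m (3≤ 2) refl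
  construction 3 = explicit-realisation m 19 word₁₉ 6≤m (3≤ 3) refl refl refl refl 39 refl
  construction (suc (suc (suc (suc k)))) =
    let q , r , eq = 20+k≡3q+11r k in periodic-realisation m (20 + k) q r 6≤m (3≤ (4 + k)) eq

lower-bound-V₁ : ∀ {m n} (R : VSet m (suc n)) → 3 ≤ suc n → 6 ≤ m → Border2DomV1 R → ω₂-value (suc n) ℤ.≤ ω₂ R
lower-bound-V₁ {n = n} R 3≤N 6≤m dom = ω₂-value≤ω₂ λ none exceptional →
  no-critical-cycle n w (exceptional⇒noCriticalCycle (suc n) exceptional) (everywhere-critical none)
  where open LowerBound R 3≤N 6≤m dom

lower-bound : ∀ {m n} (R : VSet m (suc n)) → 3 ≤ suc n → 6 ≤ m → Border2Dominating R → ω₂-value (suc n) ℤ.≤ ω₂ R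
lower-bound R 3≤N 6≤m (inj₁ dom) = lower-bound-V₁ R 3≤N 6≤m dom
lower-bound {n = n} R 3≤N 6≤m (inj₂ dom) = subst (ω₂-value (suc n) ℤ.≤_) (ω₂-flipRows R 3≤N)
  (lower-bound-V₁ (flipRows R) 3≤N 6≤m (flipRows-Border2DomV3 R 3≤N 6≤m dom))

lemma2p4 : (m n : ℕ) → 13 ≤ m → 16 ≤ n →
    (∃ λ (R : VSet m n) → Border2Dominating R × ω₂ R ≡ ω₂-value n)
    × (∀ (R : VSet m n) → Border2Dominating R → ω₂-value n ℤ.≤ ω₂ R)
lemma2p4 m zero    _   ()
lemma2p4 m (suc n) 13≤m 16≤n =
  subst (λ N → ∃ λ (R : VSet m N) → Border2Dominating R × ω₂ R ≡ ω₂-value N) (proj₂ k) (upper-bound m (proj₁ k) 6≤m) ,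
  λ R → lower-bound R (≤-trans (m≤m+n 3 13) 16≤n) 6≤m
  where
  k : ∃ λ k → 16 + k ≡ suc n
  k = m≤n⇒∃[o]m+o≡n 16≤n
  6≤m : 6 ≤ m
  6≤m = ≤-trans (m≤m+n 6 7) 13≤m
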